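{- Let $d \ge 2$. For every regular convex independent set $C \subset \mathbb{R}^d$ there exist a convex cap $C_A \subseteq C$ and a convex cup $C_B \subseteq C$ such that $C_A \cup C_B = C$ and $C_A \cap C_B = \partial_\pi C$.
   Context: For $x = (x_1,\dots,x_d)$, $\pi(x) = (x_1,\dots,x_{d-1})$ and $h(x) = x_d$. For a finite set $P$, $\operatorname{span}(P)$ is its affine span, $\operatorname{conv}(P)$ its convex hull and $\operatorname{conv}_0(P)$ the interior of its convex hull; $\partial_\pi P = \{p \in P : \pi(p) \notin \operatorname{conv}_0(\pi(P))\}$ (interior taken in $\mathbb{R}^{d-1}$). A set in $\mathbb{R}^m$ is in affinely general position if any $m+1$ distinct points of it are affinely independent. A finite $P \subset \mathbb{R}^d$ is regular if (R1) the projection of $P$ to each coordinate axis is injective, (R2) $\pi(P)$ is in affinely general position in $\mathbb{R}^{d-1}$, and (R3) for all disjoint nonempty $S,T \subset P$ with $|S|+|T| = d+1$, $|\operatorname{span}(\pi(S)) \cap \operatorname{span}(\pi(T))| = 1$. A regular $P$ is a convex cup if for all $p, p_1,\dots,p_d \in P$ and $c_1,\dots,c_d \in (0,1)$ with $\sum c_i = 1$, $\pi(p) = \sum c_i \pi(p_i)$ implies $h(p) < \sum c_i h(p_i)$; it is a convex cap if the same hypothesis implies $h(p) > \sum c_i h(p_i)$. A set is in general position if no $d+1$ points lie on a hyperplane; a set is convex independent if it is in general position and its points are the vertices of a convex polytope. -}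

module Defs where

open import Level using (0ℓ)
open import Data.Nat as ℕ using (ℕ; zero; suc)
open import Data.Fin using (Fin; zero; suc; inject₁; fromℕ)
open import Data.Fin.Subset as Sub using (Subset; _∈_; _∉_; _⊆_; ∣_∣; Nonempty)
open import Data.Product using (Σ; Σ-syntax; ∃; ∃-syntax; _×_; _,_)
open import Data.Sum using (_⊎_)
open import Relation.Nullary using (¬_)
open import Relation.Binary.PropositionalEquality using (_≡_; _≢_)
open import Relation.Binary.Structures using (IsStrictTotalOrder)
open import Algebra.Structures using (IsCommutativeRing)
open import Function.Definitions using (Injective)

-- An axiomatisation of the real numbers: a Dedekind-complete ordered
-- field (any model is isomorphic to ℝ).  Equality is propositional.

record RealField : Set₁ where
  infixl 6 _+_
  infixl 7 _*_
  infix 4 _<_ _≤_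
  infixl 6 _-_
  field
    ℝ   : Set
    _+_ _*_ : ℝ → ℝ → ℝ
    -_  : ℝ → ℝ
    0r 1r : ℝ
    _<_ : ℝ → ℝ → Set
    isCommutativeRing : IsCommutativeRing _≡_ _+_ _*_ -_ 0r 1r
    0≢1        : 0r ≢ 1r
    inverse    : ∀ x → x ≢ 0r → ∃[ y ] (x * y ≡ 1r)
    isStrictTotalOrder : IsStrictTotalOrder _≡_ _<_
    +-mono-<   : ∀ {x y} z → x < y → x + z < y + z
    *-pos      : ∀ {x y} → 0r < x → 0r < y → 0r < x * y

  _≤_ : ℝ → ℝ → Set
  x ≤ y = x < y ⊎ x ≡ y

  _-_ : ℝ → ℝ → ℝ
  x - y = x + (- y)

  field
    complete : (S : ℝ → Set) → (∃[ x ] S x) → (∃[ b ] (∀ x → S x → x ≤ b)) →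
               ∃[ s ] ((∀ x → S x → x ≤ s) × (∀ b → (∀ x → S x → x ≤ b) → s ≤ b))

module Geometry (R : RealField) where
  open RealField R public

  Pt : ℕ → Set
  Pt m = Fin m → ℝ

  _≈_ : ∀ {m} → Pt m → Pt m → Set
  x ≈ y = ∀ k → x k ≡ y k

  0v : ∀ {m} → Pt m
  0v _ = 0r

  ∑ : ∀ {n} → (Fin n → ℝ) → ℝ
  ∑ {zero}  _ = 0r
  ∑ {suc n} f = f zero + ∑ (λ i → f (suc i))

  lin : ∀ {n m} → (Fin n → ℝ) → (Fin n → Pt m) → Pt m
  lin c x k = ∑ (λ i → c i * x i k)

  -- for x = (x_1,…,x_{d}) with d = suc m: π x = (x_1,…,x_{d-1}), h x = x_d
  π : ∀ {m} → Pt (suc m) → Pt m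
  π x k = x (inject₁ k)

  h : ∀ {m} → Pt (suc m) → ℝ
  h {m} x = x (fromℕ m)

  -- A finite point configuration is an indexed family  P : Fin n → Pt m ;
  -- a subset of it is given by a  Subset n  of indices.

  SupportedOn : ∀ {n} → Subset n → (Fin n → ℝ) → Set
  SupportedOn S c = ∀ i → i ∉ S → c i ≡ 0r

  InSpan : ∀ {n m} → (Fin n → Pt m) → Subset n → Pt m → Set
  InSpan P S y = Σ[ c ∈ (Fin _ → ℝ) ] (SupportedOn S c × ∑ c ≡ 1r × lin c P ≈ y)

  InConv : ∀ {n m} → (Fin n → Pt m) → Subset n → Pt m → Set
  InConv P S y = Σ[ c ∈ (Fin _ → ℝ) ]
    (SupportedOn S c × (∀ i → 0r ≤ c i) × ∑ c ≡ 1r × lin c P ≈ y)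

  InConv₀ : ∀ {n m} → (Fin n → Pt m) → Subset n → Pt m → Set
  InConv₀ {m = m} P S y = Σ[ ε ∈ ℝ ] (0r < ε ×
    (∀ (z : Pt m) → (∀ k → (y k - ε < z k) × (z k < y k + ε)) → InConv P S z))

  AffIndep : ∀ {r m} → (Fin r → Pt m) → Set
  AffIndep x = ∀ c → ∑ c ≡ 0r → lin c x ≈ 0v → ∀ i → c i ≡ 0r

  AffGenPos : ∀ {n m} → (Fin n → Pt m) → Subset n → Set
  AffGenPos {n} {m} P S = ∀ (f : Fin (suc m) → Fin n) → Injective _≡_ _≡_ f →
    (∀ j → f j ∈ S) → AffIndep (λ j → P (f j))

  R1 : ∀ {n m} → (Fin n → Pt (suc m)) → Subset n → Set
  R1 P M = ∀ k i j → i ∈ M → j ∈ M → P i k ≡ P j k → i ≡ j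

  R2 : ∀ {n m} → (Fin n → Pt (suc m)) → Subset n → Set
  R2 P M = AffGenPos (λ i → π (P i)) M

  Disjoint : ∀ {n} → Subset n → Subset n → Set
  Disjoint S T = ∀ i → i ∈ S → i ∉ T

  R3 : ∀ {n m} → (Fin n → Pt (suc m)) → Subset n → Set
  R3 {n} {m} P M = ∀ (S T : Subset n) → S ⊆ M → T ⊆ M → Disjoint S T →
    Nonempty S → Nonempty T → ∣ S ∣ ℕ.+ ∣ T ∣ ≡ suc (suc m) →
    Σ[ y ∈ Pt m ] ((InSpan πP S y × InSpan πP T y) ×
      (∀ z → InSpan πP S z → InSpan πP T z → z ≈ y))
    where πP = λ i → π (P i)

  Regular : ∀ {n m} → (Fin n → Pt (suc m)) → Subset n → Set
  Regular P M = R1 P M × R2 P M × R3 P M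

  CupCapCond : ∀ {n m} → (ℝ → ℝ → Set) → (Fin n → Pt (suc m)) → Subset n → Set
  CupCapCond {n} {m} Rel P M =
    ∀ (p : Fin n) (ps : Fin (suc m) → Fin n) (c : Fin (suc m) → ℝ) →
      p ∈ M → (∀ j → ps j ∈ M) → Injective _≡_ _≡_ ps → (∀ j → ps j ≢ p) →
      (∀ j → (0r < c j) × (c j < 1r)) → ∑ c ≡ 1r →
      π (P p) ≈ lin c (λ j → π (P (ps j))) →
      Rel (h (P p)) (∑ (λ j → c j * h (P (ps j))))

  ConvexCup : ∀ {n m} → (Fin n → Pt (suc m)) → Subset n → Set
  ConvexCup P M = Regular P M × CupCapCond _<_ P M

  ConvexCap : ∀ {n m} → (Fin n → Pt (suc m)) → Subset n → Set
  ConvexCap P M = Regular P M × CupCapCond (λ a b → b < a) P M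

  -- general position in ℝ^d: no d+1 points on a hyperplane
  GenPos : ∀ {n m} → (Fin n → Pt m) → Subset n → Set
  GenPos = AffGenPos

  ConvexIndependent : ∀ {n m} → (Fin n → Pt m) → Set
  ConvexIndependent {n} P = GenPos P Sub.⊤ ×
    (∀ i → ¬ InConv P (Sub.⊤ Sub.- i) (P i))

  In∂π : ∀ {n m} → (Fin n → Pt (suc m)) → Fin n → Set
  In∂π P i = ¬ InConv₀ (λ j → π (P j)) Sub.⊤ (π (P i))

-- Call p below (above) if π p lies in an open simplex spanned by the projections of d other points
-- and p lies strictly below (above) the hyperplane through those points. Let A be the points that
-- are not below and B those not above. By general position no point lies on such a hyperplane,
-- so A is a cap and B a cup. No point is both below and above: interpolating between the two
-- hyperplanes writes p as a convex combination of the other points. Finally p is neither iff no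
-- such open simplex exists, which by Carathéodory's theorem and the general position of π C
-- happens iff π p is not interior to conv (π C). Membership in A and B is decided with the weak
-- excluded middle, which follows from the completeness of ℝ.
module Submission where

open import Defs
open import Data.Nat using (ℕ; suc)
open import Data.Fin using (Fin)
open import Data.Fin.Subset using (Subset; _∈_; ⊤)
open import Data.Product using (Σ-syntax; _×_; _,_)
open import Data.Sum using (_⊎_; inj₁; inj₂; [_,_])
open import Function.Bundles using (_⇔_; mk⇔)
open import Relation.Binary.PropositionalEquality
  using (_≡_; _≢_; refl; sym; trans; cong; cong₂; subst; subst₂; module ≡-Reasoning)

-- The ring solver needs a coefficient ring whose equality computes, so ℤ is embedded into ℝ.
module IntegerCoefficients (R : RealField) where
  open RealField R using (ℝ; _+_; _*_; -_; 0r; 1r; isCommutativeRing)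
  open import Data.Nat as ℕ using (ℕ; zero; suc)
  import Data.Nat.Properties as ℕ
  open import Data.Integer as ℤ using (ℤ; -[1+_]; _⊖_)
  import Data.Integer.Properties as ℤ
  open import Data.Sign as Sign using (Sign)
  open import Data.Maybe using (Maybe; just; nothing)
  open import Relation.Nullary using (yes; no)
  open import Algebra.Bundles using (CommutativeRing)
  open import Algebra.Solver.Ring.AlmostCommutativeRing
    using (AlmostCommutativeRing; fromCommutativeRing; _-Raw-AlmostCommutative⟶_)
  import Algebra.Solver.Ring as Solver

  commutativeRing : CommutativeRing _ _
  commutativeRing = record { isCommutativeRing = isCommutativeRing }

  open CommutativeRing commutativeRing
    using (+-comm; +-assoc; *-identityˡ; *-identityʳ; zeroʳ; +-identityˡ; +-identityʳ; semiring; ring; *-commutativeSemigroup)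
  open import Algebra.Properties.Ring ring
    using (-0#≈0#; -‿involutive; -‿+-comm; -‿anti-homo-+; -1*x≈-x; xyx⁻¹≈y)
  open import Algebra.Properties.CommutativeSemigroup *-commutativeSemigroup
    using () renaming (interchange to *-interchange)
  open import Algebra.Properties.Semiring.Mult.TCOptimised semiring
    using (1+×; ×-homo-+; ×1-homo-*) renaming (_×_ to _×ₙ_)

  ι : ℕ → ℝ
  ι n = n ×ₙ 1r

  ⟦_⟧ : ℤ → ℝ
  ⟦ ℤ.+ n ⟧ = ι n
  ⟦ -[1+ n ] ⟧ = - ι (suc n)

  sgn : Sign → ℝ
  sgn Sign.+ = 1r
  sgn Sign.- = - 1r

  ⊖-homo : ∀ m n → ⟦ m ⊖ n ⟧ ≡ ι m + - ι n
  ⊖-homo zero zero = trans (sym (+-identityʳ 0r)) (cong (0r +_) (sym -0#≈0#))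
  ⊖-homo (suc m) zero = trans (sym (+-identityʳ _)) (cong (ι (suc m) +_) (sym -0#≈0#))
  ⊖-homo zero (suc n) = sym (+-identityˡ _)
  ⊖-homo (suc m) (suc n) = begin
    ⟦ suc m ⊖ suc n ⟧                 ≡⟨ cong ⟦_⟧ (ℤ.[1+m]⊖[1+n]≡m⊖n m n) ⟩
    ⟦ m ⊖ n ⟧                         ≡⟨ ⊖-homo m n ⟩
    ι m + - ι n                       ≡⟨ sym (xyx⁻¹≈y 1r (ι m + - ι n)) ⟩
    1r + (ι m + - ι n) + - 1r         ≡⟨ cong (_+ - 1r) (sym (+-assoc 1r (ι m) (- ι n))) ⟩
    (1r + ι m + - ι n) + - 1r         ≡⟨ +-assoc (1r + ι m) (- ι n) (- 1r) ⟩
    1r + ι m + (- ι n + - 1r)         ≡⟨ cong₂ _+_ (sym (1+× m 1r)) (sym (-‿anti-homo-+ 1r (ι n))) ⟩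
    ι (suc m) + - (1r + ι n)          ≡⟨ cong (λ a → ι (suc m) + - a) (sym (1+× n 1r)) ⟩
    ι (suc m) + - ι (suc n)           ∎
    where open ≡-Reasoning

  +-homo : ∀ i j → ⟦ i ℤ.+ j ⟧ ≡ ⟦ i ⟧ + ⟦ j ⟧
  +-homo (ℤ.+ m) (ℤ.+ n) = ×-homo-+ 1r m n
  +-homo (ℤ.+ m) -[1+ n ] = ⊖-homo m (suc n)
  +-homo -[1+ m ] (ℤ.+ n) = trans (⊖-homo n (suc m)) (+-comm _ _)
  +-homo -[1+ m ] -[1+ n ] = begin
    - ι (suc (suc (m ℕ.+ n)))        ≡⟨ cong (λ k → - ι (suc k)) (sym (ℕ.+-suc m n)) ⟩
    - ι (suc m ℕ.+ suc n)            ≡⟨ cong -_ (×-homo-+ 1r (suc m) (suc n)) ⟩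
    - (ι (suc m) + ι (suc n))        ≡⟨ sym (-‿+-comm (ι (suc m)) (ι (suc n))) ⟩
    - ι (suc m) + - ι (suc n)        ∎
    where open ≡-Reasoning

  sgn-homo : ∀ s t → sgn (s Sign.* t) ≡ sgn s * sgn t
  sgn-homo Sign.+ t = sym (*-identityˡ (sgn t))
  sgn-homo Sign.- Sign.+ = sym (*-identityʳ (- 1r))
  sgn-homo Sign.- Sign.- = sym (trans (-1*x≈-x (- 1r)) (-‿involutive 1r))

  ◃-homo : ∀ s n → ⟦ s ℤ.◃ n ⟧ ≡ sgn s * ι n
  ◃-homo s zero = sym (zeroʳ (sgn s))
  ◃-homo Sign.+ (suc n) = sym (*-identityˡ _)
  ◃-homo Sign.- (suc n) = sym (-1*x≈-x _)

  sign-abs : ∀ i → ⟦ i ⟧ ≡ sgn (ℤ.sign i) * ι ℤ.∣ i ∣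
  sign-abs (ℤ.+ n) = sym (*-identityˡ _)
  sign-abs -[1+ n ] = sym (-1*x≈-x _)

  *-homo : ∀ i j → ⟦ i ℤ.* j ⟧ ≡ ⟦ i ⟧ * ⟦ j ⟧
  *-homo i j = begin
    ⟦ s ℤ.◃ ∣i∣ ℕ.* ∣j∣ ⟧                    ≡⟨ ◃-homo s (∣i∣ ℕ.* ∣j∣) ⟩
    sgn s * ι (∣i∣ ℕ.* ∣j∣)                  ≡⟨ cong₂ _*_ (sgn-homo (ℤ.sign i) (ℤ.sign j)) (×1-homo-* ∣i∣ ∣j∣) ⟩
    (sgn (ℤ.sign i) * sgn (ℤ.sign j)) * (ι ∣i∣ * ι ∣j∣)  ≡⟨ *-interchange _ _ _ _ ⟩
    (sgn (ℤ.sign i) * ι ∣i∣) * (sgn (ℤ.sign j) * ι ∣j∣)  ≡⟨ sym (cong₂ _*_ (sign-abs i) (sign-abs j)) ⟩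
    ⟦ i ⟧ * ⟦ j ⟧                             ∎
    where
    open ≡-Reasoning
    s = ℤ.sign i Sign.* ℤ.sign j
    ∣i∣ = ℤ.∣ i ∣
    ∣j∣ = ℤ.∣ j ∣

  -‿homo : ∀ i → ⟦ ℤ.- i ⟧ ≡ - ⟦ i ⟧
  -‿homo -[1+ n ] = sym (-‿involutive _)
  -‿homo (ℤ.+ zero) = sym -0#≈0#
  -‿homo (ℤ.+ suc n) = refl

  almostCommutativeRing : AlmostCommutativeRing _ _
  almostCommutativeRing = fromCommutativeRing commutativeRing

  homomorphism : ℤ.+-*-rawRing -Raw-AlmostCommutative⟶ almostCommutativeRing
  homomorphism = record
    { ⟦_⟧ = ⟦_⟧ ; +-homo = +-homo ; *-homo = *-homo ; -‿homo = -‿homo ; 0-homo = refl ; 1-homo = refl }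

  ⟦⟧-≟ : ∀ i j → Maybe (⟦ i ⟧ ≡ ⟦ j ⟧)
  ⟦⟧-≟ i j with i ℤ.≟ j
  ... | yes i≡j = just (cong ⟦_⟧ i≡j)
  ... | no _ = nothing

  open Solver ℤ.+-*-rawRing almostCommutativeRing homomorphism ⟦⟧-≟ public
    using (solve; _:=_; _:+_; _:*_; _:-_; :-_; con; Polynomial)

module FinMaps where
  open import Data.Nat as ℕ using (zero)
  open import Data.Fin as Fin using (zero; suc)
  import Data.Fin.Properties as Fin
  open import Data.Vec.Functional using (_∷_)
  open import Data.Product using (proj₁; proj₂; ∃-syntax)
  open import Data.Empty using (⊥-elim)
  open import Relation.Nullary using (¬_; yes; no; ¬?)
  open import Function.Definitions using (Injective)

  ∷-injective : ∀ {r n} {p : Fin n} {ps : Fin r → Fin n} → Injective _≡_ _≡_ ps → (∀ j → ps j ≢ p) →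
    Injective _≡_ _≡_ (p ∷ ps)
  ∷-injective ps-inj ps≢p {zero} {zero} _ = refl
  ∷-injective ps-inj ps≢p {zero} {suc j} p≡psj = ⊥-elim (ps≢p j (sym p≡psj))
  ∷-injective ps-inj ps≢p {suc i} {zero} psi≡p = ⊥-elim (ps≢p i psi≡p)
  ∷-injective ps-inj ps≢p {suc i} {suc j} psi≡psj = cong suc (ps-inj psi≡psj)

  inject₁⊎fromℕ : ∀ {r} (l : Fin (suc r)) → (∃[ l′ ] l ≡ Fin.inject₁ l′) ⊎ l ≡ Fin.fromℕ r
  inject₁⊎fromℕ {zero} zero = inj₂ refl
  inject₁⊎fromℕ {suc r} zero = inj₁ (zero , refl)
  inject₁⊎fromℕ {suc r} (suc l) with inject₁⊎fromℕ l
  ... | inj₁ (l′ , l≡) = inj₁ (suc l′ , cong suc l≡)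
  ... | inj₂ l≡ = inj₂ (cong suc l≡)

  anotherElement : ∀ {n} → 2 ℕ.≤ n → (p : Fin n) → ∃[ q ] q ≢ p
  anotherElement {suc zero} (ℕ.s≤s ()) zero
  anotherElement {suc (suc n)} _ zero = suc zero , λ ()
  anotherElement {suc (suc n)} _ (suc p) = zero , λ ()

  noDuplicate⇒injective : ∀ {r n} {g : Fin r → Fin n} → ¬ (∃[ i ] ∃[ j ] (i ≢ j × g i ≡ g j)) →
    Injective _≡_ _≡_ g
  noDuplicate⇒injective ¬duplicate {i} {j} gi≡gj with i Fin.≟ j
  ... | yes i≡j = i≡j
  ... | no i≢j = ⊥-elim (¬duplicate (i , j , i≢j , gi≡gj))

  ¬outside⇒surjective : ∀ {s n} (f : Fin s → Fin n) → ¬ (∃[ i ] (∀ j → f j ≢ i)) → ∀ i → ∃[ j ] f j ≡ i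
  ¬outside⇒surjective f ¬outside i with Fin.any? (λ j → f j Fin.≟ i)
  ... | yes found = found
  ... | no ¬found = ⊥-elim (¬outside (i , λ j fj≡i → ¬found (j , fj≡i)))

  outsideImage : ∀ {s n} → s ℕ.< n → (f : Fin s → Fin n) → ∃[ i ] (∀ j → f j ≢ i)
  outsideImage s<n f with Fin.any? (λ i → Fin.all? (λ j → ¬? (f j Fin.≟ i)))
  ... | yes outside = outside
  ... | no ¬outside
    with i , j , i<j , same ← Fin.pigeonhole s<n (λ i → proj₁ (¬outside⇒surjective f ¬outside i)) =
    ⊥-elim (Fin.<-irrefl (trans (sym (preimage≡ i)) (trans (cong f same) (preimage≡ j))) i<j)
    where preimage≡ = λ i → proj₂ (¬outside⇒surjective f ¬outside i)

module OrderedField (R : RealField) where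
  open import Data.Integer as ℤ using ()
  open import Data.Product using (proj₁; proj₂; ∃-syntax)
  open import Data.Empty using (⊥-elim)
  open import Relation.Nullary using (¬_; Dec; yes; no)
  open import Relation.Binary.Definitions using (tri<; tri≈; tri>)
  open import Relation.Binary.Structures using (IsStrictTotalOrder)
  open import Algebra.Structures using (IsCommutativeRing)

  open Geometry R public
  open IsCommutativeRing isCommutativeRing public
    using (+-comm; +-assoc; *-comm; *-assoc; +-identityˡ; +-identityʳ; *-identityˡ; *-identityʳ;
           distribˡ; distribʳ; zeroˡ; zeroʳ; -‿inverseˡ; -‿inverseʳ)
  open IsStrictTotalOrder isStrictTotalOrder public using (compare; asym) renaming (trans to <-trans)
  open IntegerCoefficients R public using (solve; _:=_; _:+_; _:*_; _:-_; :-_)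
  open IntegerCoefficients R using (Polynomial; con)

  :0 :1 : ∀ {k} → Polynomial k
  :0 = con (ℤ.+ 0)
  :1 = con (ℤ.+ 1)

  -‿unique : ∀ a b → a + b ≡ 0r → b ≡ - a
  -‿unique a b a+b≡0 = begin
    b               ≡⟨ solve 2 (λ a b → b := :- a :+ (a :+ b)) refl a b ⟩
    - a + (a + b)   ≡⟨ cong (- a +_) a+b≡0 ⟩
    - a + 0r        ≡⟨ +-identityʳ (- a) ⟩
    - a             ∎
    where open ≡-Reasoning

  -0≡0 : - 0r ≡ 0r
  -0≡0 = solve 0 (:- :0 := :0) refl

  -1≢0 : - 1r ≢ 0r
  -1≢0 -1≡0 = 0≢1 (sym (trans (solve 0 (:1 := :- (:- :1)) refl) (trans (cong -_ -1≡0) -0≡0)))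

  _≟_ : (x y : ℝ) → Dec (x ≡ y)
  x ≟ y with compare x y
  ... | tri< _ x≢y _ = no x≢y
  ... | tri≈ _ x≡y _ = yes x≡y
  ... | tri> _ x≢y _ = no x≢y

  _<?_ : (x y : ℝ) → Dec (x < y)
  x <? y with compare x y
  ... | tri< x<y _ _ = yes x<y
  ... | tri≈ x≮y _ _ = no x≮y
  ... | tri> x≮y _ _ = no x≮y

  <-irrefl : ∀ {x} → ¬ (x < x)
  <-irrefl {x} x<x = asym x<x x<x

  ≤-refl : ∀ {x} → x ≤ x
  ≤-refl = inj₂ refl

  ≤-trans : ∀ {x y z} → x ≤ y → y ≤ z → x ≤ z
  ≤-trans (inj₁ x<y) (inj₁ y<z) = inj₁ (<-trans x<y y<z)
  ≤-trans x≤y (inj₂ refl) = x≤y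
  ≤-trans (inj₂ refl) y≤z = y≤z

  <-≤-trans : ∀ {x y z} → x < y → y ≤ z → x < z
  <-≤-trans x<y (inj₁ y<z) = <-trans x<y y<z
  <-≤-trans x<y (inj₂ refl) = x<y

  ≤-<-trans : ∀ {x y z} → x ≤ y → y < z → x < z
  ≤-<-trans (inj₁ x<y) y<z = <-trans x<y y<z
  ≤-<-trans (inj₂ refl) y<z = y<z

  ≤-antisym : ∀ {x y} → x ≤ y → y ≤ x → x ≡ y
  ≤-antisym (inj₂ x≡y) _ = x≡y
  ≤-antisym (inj₁ _) (inj₂ y≡x) = sym y≡x
  ≤-antisym (inj₁ x<y) (inj₁ y<x) = ⊥-elim (asym x<y y<x)

  ≮⇒≥ : ∀ {x y} → ¬ (x < y) → y ≤ x
  ≮⇒≥ {x} {y} x≮y with compare x y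
  ... | tri< x<y _ _ = ⊥-elim (x≮y x<y)
  ... | tri≈ _ x≡y _ = inj₂ (sym x≡y)
  ... | tri> _ _ y<x = inj₁ y<x

  ≤⇒≯ : ∀ {x y} → x ≤ y → ¬ (y < x)
  ≤⇒≯ (inj₁ x<y) = asym x<y
  ≤⇒≯ (inj₂ refl) = <-irrefl

  ≤⊎> : ∀ x y → x ≤ y ⊎ y < x
  ≤⊎> x y with compare x y
  ... | tri< x<y _ _ = inj₁ (inj₁ x<y)
  ... | tri≈ _ x≡y _ = inj₁ (inj₂ x≡y)
  ... | tri> _ _ y<x = inj₂ y<x

  +-monoʳ-< : ∀ {a b} c → a < b → c + a < c + b
  +-monoʳ-< {a} {b} c a<b = subst₂ _<_ (+-comm a c) (+-comm b c) (+-mono-< c a<b)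

  +-monoˡ-≤ : ∀ {a b} c → a ≤ b → a + c ≤ b + c
  +-monoˡ-≤ c (inj₁ a<b) = inj₁ (+-mono-< c a<b)
  +-monoˡ-≤ c (inj₂ refl) = ≤-refl

  +-monoʳ-≤ : ∀ {a b} c → a ≤ b → c + a ≤ c + b
  +-monoʳ-≤ c (inj₁ a<b) = inj₁ (+-monoʳ-< c a<b)
  +-monoʳ-≤ c (inj₂ refl) = ≤-refl

  +-mono-≤ : ∀ {a b c d} → a ≤ b → c ≤ d → a + c ≤ b + d
  +-mono-≤ {b = b} {c} a≤b c≤d = ≤-trans (+-monoˡ-≤ c a≤b) (+-monoʳ-≤ b c≤d)

  +-mono-<-≤ : ∀ {a b c d} → a < b → c ≤ d → a + c < b + d
  +-mono-<-≤ {b = b} {c} a<b c≤d = <-≤-trans (+-mono-< c a<b) (+-monoʳ-≤ b c≤d)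

  -‿antimono-< : ∀ {a b} → a < b → - b < - a
  -‿antimono-< {a} {b} a<b = subst₂ _<_ (solve 2 (λ a b → a :+ (:- a :- b) := :- b) refl a b)
                                        (solve 2 (λ a b → b :+ (:- a :- b) := :- a) refl a b)
                                        (+-mono-< (- a - b) a<b)

  -‿antimono-≤ : ∀ {a b} → a ≤ b → - b ≤ - a
  -‿antimono-≤ (inj₁ a<b) = inj₁ (-‿antimono-< a<b)
  -‿antimono-≤ (inj₂ refl) = ≤-refl

  x<y⇒0<y-x : ∀ {x y} → x < y → 0r < y - x
  x<y⇒0<y-x {x} {y} x<y = subst (_< y - x) (solve 1 (λ x → x :- x := :0) refl x) (+-mono-< (- x) x<y)

  x≤y⇒0≤y-x : ∀ {x y} → x ≤ y → 0r ≤ y - x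
  x≤y⇒0≤y-x (inj₁ x<y) = inj₁ (x<y⇒0<y-x x<y)
  x≤y⇒0≤y-x {x} (inj₂ refl) = inj₂ (sym (-‿inverseʳ x))

  0<y-x⇒x<y : ∀ {x y} → 0r < y - x → x < y
  0<y-x⇒x<y {x} {y} 0<y-x =
    subst₂ _<_ (+-identityˡ x) (solve 2 (λ x y → y :- x :+ x := y) refl x y) (+-mono-< x 0<y-x)

  0<1 : 0r < 1r
  0<1 with compare 0r 1r
  ... | tri< 0<1 _ _ = 0<1
  ... | tri≈ _ 0≡1 _ = ⊥-elim (0≢1 0≡1)
  ... | tri> _ _ 1<0 = ⊥-elim (asym 1<0 (subst (0r <_) (solve 0 (:- :1 :* :- :1 := :1) refl) (*-pos 0<-1 0<-1)))
    where
    0<-1 : 0r < - 1r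
    0<-1 = subst (_< - 1r) -0≡0 (-‿antimono-< 1<0)

  *-monoˡ-<-pos : ∀ {a b c} → 0r < c → a < b → a * c < b * c
  *-monoˡ-<-pos {a} {b} {c} 0<c a<b = 0<y-x⇒x<y
    (subst (0r <_) (solve 3 (λ a b c → (b :- a) :* c := b :* c :- a :* c) refl a b c) (*-pos (x<y⇒0<y-x a<b) 0<c))

  *-monoʳ-<-pos : ∀ {a b c} → 0r < c → a < b → c * a < c * b
  *-monoʳ-<-pos {a} {b} {c} 0<c a<b = subst₂ _<_ (*-comm a c) (*-comm b c) (*-monoˡ-<-pos 0<c a<b)

  *-monoˡ-≤-nonNeg : ∀ {a b c} → 0r ≤ c → a ≤ b → a * c ≤ b * c
  *-monoˡ-≤-nonNeg (inj₁ 0<c) (inj₁ a<b) = inj₁ (*-monoˡ-<-pos 0<c a<b)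
  *-monoˡ-≤-nonNeg _ (inj₂ refl) = ≤-refl
  *-monoˡ-≤-nonNeg {a} {b} (inj₂ refl) (inj₁ _) = inj₂ (trans (zeroʳ a) (sym (zeroʳ b)))

  *-monoʳ-≤-nonNeg : ∀ {a b c} → 0r ≤ c → a ≤ b → c * a ≤ c * b
  *-monoʳ-≤-nonNeg {a} {b} {c} 0≤c a≤b = subst₂ _≤_ (*-comm a c) (*-comm b c) (*-monoˡ-≤-nonNeg 0≤c a≤b)

  *-nonNeg : ∀ {a b} → 0r ≤ a → 0r ≤ b → 0r ≤ a * b
  *-nonNeg {a} {b} 0≤a 0≤b = subst (_≤ a * b) (zeroˡ b) (*-monoˡ-≤-nonNeg 0≤b 0≤a)

  +-nonNeg : ∀ {a b} → 0r ≤ a → 0r ≤ b → 0r ≤ a + b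
  +-nonNeg {a} {b} 0≤a 0≤b = subst (_≤ a + b) (+-identityˡ 0r) (+-mono-≤ 0≤a 0≤b)

  +-pos-nonNeg : ∀ {a b} → 0r < a → 0r ≤ b → 0r < a + b
  +-pos-nonNeg {a} {b} 0<a 0≤b = subst (_< a + b) (+-identityˡ 0r) (+-mono-<-≤ 0<a 0≤b)

  0<⇒≢0 : ∀ {x} → 0r < x → x ≢ 0r
  0<⇒≢0 0<x refl = <-irrefl 0<x

  -- 0r ⁻¹ is a junk value, 0r.
  infix 21 _⁻¹
  _⁻¹ : ℝ → ℝ
  x ⁻¹ with x ≟ 0r
  ... | yes _ = 0r
  ... | no x≢0 = proj₁ (inverse x x≢0)

  *-inverseʳ : ∀ {x} → x ≢ 0r → x * x ⁻¹ ≡ 1r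
  *-inverseʳ {x} x≢0 with x ≟ 0r
  ... | yes x≡0 = ⊥-elim (x≢0 x≡0)
  ... | no x≢0′ = proj₂ (inverse x x≢0′)

  0<⇒0<⁻¹ : ∀ {x} → 0r < x → 0r < x ⁻¹
  0<⇒0<⁻¹ {x} 0<x with compare 0r (x ⁻¹)
  ... | tri< 0<x⁻¹ _ _ = 0<x⁻¹
  ... | tri≈ _ 0≡x⁻¹ _ =
    ⊥-elim (0≢1 (trans (sym (zeroʳ x)) (trans (cong (x *_) 0≡x⁻¹) (*-inverseʳ (0<⇒≢0 0<x)))))
  ... | tri> _ _ x⁻¹<0 =
    ⊥-elim (asym 0<1 (subst₂ _<_ (*-inverseʳ (0<⇒≢0 0<x)) (zeroʳ x) (*-monoʳ-<-pos 0<x x⁻¹<0)))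

  infixl 7 _/_
  _/_ : ℝ → ℝ → ℝ
  a / b = a * b ⁻¹

  /-*-cancel : ∀ a {b} → b ≢ 0r → a / b * b ≡ a
  /-*-cancel a {b} b≢0 = trans (solve 3 (λ a b i → a :* i :* b := a :* (b :* i)) refl a b (b ⁻¹))
                               (trans (cong (a *_) (*-inverseʳ b≢0)) (*-identityʳ a))

  *-/-cancel : ∀ a {b} → b ≢ 0r → a * b / b ≡ a
  *-/-cancel a {b} b≢0 = trans (*-assoc a b (b ⁻¹)) (trans (cong (a *_) (*-inverseʳ b≢0)) (*-identityʳ a))

  /-pos : ∀ {a b} → 0r < a → 0r < b → 0r < a / b
  /-pos 0<a 0<b = *-pos 0<a (0<⇒0<⁻¹ 0<b)

  /-nonNeg : ∀ {a b} → 0r ≤ a → 0r < b → 0r ≤ a / b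
  /-nonNeg 0≤a 0<b = *-nonNeg 0≤a (inj₁ (0<⇒0<⁻¹ 0<b))

  a*b≡0⇒a≡0 : ∀ {a b} → 0r < b → a * b ≡ 0r → a ≡ 0r
  a*b≡0⇒a≡0 {a} {b} 0<b ab≡0 =
    trans (sym (*-/-cancel a (0<⇒≢0 0<b))) (trans (cong (_/ b) ab≡0) (zeroˡ (b ⁻¹)))

  0<-dense : ∀ {ε} → 0r < ε → ∃[ η ] (0r < η × η < ε)
  0<-dense {ε} 0<ε = η , 0<η , η<ε
    where
    0<2 : 0r < 1r + 1r
    0<2 = +-pos-nonNeg 0<1 (inj₁ 0<1)
    η = ε / (1r + 1r)
    0<η = /-pos 0<ε 0<2
    η<ε : η < ε
    η<ε = subst₂ _<_ (+-identityʳ η)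
      (trans (solve 1 (λ e → e :+ e := e :* (:1 :+ :1)) refl η) (/-*-cancel ε (0<⇒≢0 0<2)))
      (+-monoʳ-< η 0<η)

  ∣_∣ : ℝ → ℝ
  ∣ x ∣ with x <? 0r
  ... | yes _ = - x
  ... | no _ = x

  ∣x∣-bounds : ∀ x → 0r ≤ ∣ x ∣ × x ≤ ∣ x ∣ × - x ≤ ∣ x ∣
  ∣x∣-bounds x with x <? 0r
  ... | yes x<0 = inj₁ 0<-x , inj₁ (<-trans x<0 0<-x) , ≤-refl
    where
    0<-x = subst (_< - x) -0≡0 (-‿antimono-< x<0)
  ... | no x≮0 = ≮⇒≥ x≮0 , ≤-refl , ≤-trans (-‿antimono-≤ (≮⇒≥ x≮0)) (subst (_≤ x) (sym -0≡0) (≮⇒≥ x≮0))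

  ∣d∣<ε⇒-ε∣a∣≤d*a : ∀ {d ε} a → - ε < d → d < ε → - (ε * ∣ a ∣) ≤ d * a
  ∣d∣<ε⇒-ε∣a∣≤d*a {d} {ε} a -ε<d d<ε with a <? 0r
  ... | yes a<0 = inj₁ (subst (- (ε * - a) <_) (solve 2 (λ d a → :- (d :* (:- a)) := d :* a) refl d a)
                          (-‿antimono-< (*-monoˡ-<-pos (subst (_< - a) -0≡0 (-‿antimono-< a<0)) d<ε)))
  ... | no a≮0 = subst (_≤ d * a) (solve 2 (λ ε a → (:- ε) :* a := :- (ε :* a)) refl ε a)
                   (*-monoˡ-≤-nonNeg (≮⇒≥ a≮0) (inj₁ -ε<d))


module WeakExcludedMiddle (R : RealField) where
  open import Data.Bool using (Bool; true; false)
  open import Data.Vec using (tabulate)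
  open import Data.Vec.Properties using (lookup∘tabulate; []=⇒lookup; lookup⇒[]=)
  open import Data.Empty using (⊥-elim)
  open import Relation.Nullary using (¬_)
  open import Relation.Binary.Definitions using (tri<; tri≈; tri>)
  open import Function.Bundles using (Equivalence)

  open OrderedField R

  -- Completeness gives the weak excluded middle: the supremum of {0} ∪ {1 | Q} is 0 or positive.
  ¬⊎¬¬ : (Q : Set) → ¬ Q ⊎ ¬ ¬ Q
  ¬⊎¬¬ Q with complete S (0r , inj₁ refl) (1r , S≤1)
    where
    S : ℝ → Set
    S y = y ≡ 0r ⊎ (y ≡ 1r × Q)
    S≤1 : ∀ y → S y → y ≤ 1r
    S≤1 y (inj₁ refl) = inj₁ 0<1
    S≤1 y (inj₂ (refl , _)) = ≤-refl
  ... | s , upper , least with compare s 0r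
  ... | tri< s<0 _ _ = ⊥-elim (≤⇒≯ (upper 0r (inj₁ refl)) s<0)
  ... | tri≈ _ s≡0 _ = inj₁ (λ q → ≤⇒≯ (subst (1r ≤_) s≡0 (upper 1r (inj₂ (refl , q)))) 0<1)
  ... | tri> _ _ 0<s = inj₂ (λ ¬q → ≤⇒≯ (least 0r (λ { y (inj₁ refl) → ≤-refl ; y (inj₂ (_ , q)) → ⊥-elim (¬q q) })) 0<s)

  refuted? : Set → Bool
  refuted? Q with ¬⊎¬¬ Q
  ... | inj₁ _ = true
  ... | inj₂ _ = false

  refuted?≡true⇔¬ : ∀ Q → refuted? Q ≡ true ⇔ (¬ Q)
  refuted?≡true⇔¬ Q with ¬⊎¬¬ Q
  ... | inj₁ ¬q = mk⇔ (λ _ → ¬q) (λ _ → refl)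
  ... | inj₂ ¬¬q = mk⇔ (λ ()) (λ ¬q → ⊥-elim (¬¬q ¬q))

  failures : ∀ {n} → (Fin n → Set) → Subset n
  failures P = tabulate (λ i → refuted? (P i))

  ∈failures⇔¬ : ∀ {n} (P : Fin n → Set) i → i ∈ failures P ⇔ (¬ P i)
  ∈failures⇔¬ P i = mk⇔
    (λ i∈ → Equivalence.to (refuted?≡true⇔¬ (P i)) (trans (sym (lookup∘tabulate _ i)) ([]=⇒lookup i∈)))
    (λ ¬Pi → lookup⇒[]= i (failures P) (trans (lookup∘tabulate _ i) (Equivalence.from (refuted?≡true⇔¬ (P i)) ¬Pi)))

module Sums (R : RealField) where
  open import Data.Nat using (zero)
  open import Data.Fin as Fin using (zero; suc; punchIn)
  import Data.Fin.Properties as Fin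
  open import Data.Product using (∃-syntax)
  open import Data.Empty using (⊥; ⊥-elim)
  open import Relation.Nullary using (¬_; Dec; yes; no)

  open OrderedField R public

  ∑-cong : ∀ {n} {f g : Fin n → ℝ} → (∀ i → f i ≡ g i) → ∑ f ≡ ∑ g
  ∑-cong {zero} f≗g = refl
  ∑-cong {suc n} f≗g = cong₂ _+_ (f≗g zero) (∑-cong (λ i → f≗g (suc i)))

  ∑-zero : ∀ {n} {f : Fin n → ℝ} → (∀ i → f i ≡ 0r) → ∑ f ≡ 0r
  ∑-zero {zero} f≗0 = refl
  ∑-zero {suc n} f≗0 = trans (cong₂ _+_ (f≗0 zero) (∑-zero (λ i → f≗0 (suc i)))) (+-identityˡ 0r)

  ∑-+ : ∀ {n} (f g : Fin n → ℝ) → ∑ (λ i → f i + g i) ≡ ∑ f + ∑ g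
  ∑-+ {zero} f g = sym (+-identityˡ 0r)
  ∑-+ {suc n} f g = trans (cong (f zero + g zero +_) (∑-+ (λ i → f (suc i)) (λ i → g (suc i))))
    (solve 4 (λ a b c d → a :+ b :+ (c :+ d) := a :+ c :+ (b :+ d)) refl
      (f zero) (g zero) (∑ (λ i → f (suc i))) (∑ (λ i → g (suc i))))

  ∑-*ˡ : ∀ {n} a (f : Fin n → ℝ) → ∑ (λ i → a * f i) ≡ a * ∑ f
  ∑-*ˡ {zero} a f = sym (zeroʳ a)
  ∑-*ˡ {suc n} a f = trans (cong (a * f zero +_) (∑-*ˡ a (λ i → f (suc i)))) (sym (distribˡ a _ _))

  ∑-*ʳ : ∀ {n} a (f : Fin n → ℝ) → ∑ (λ i → f i * a) ≡ ∑ f * a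
  ∑-*ʳ a f = trans (∑-cong (λ i → *-comm (f i) a)) (trans (∑-*ˡ a f) (*-comm a _))

  ∑-neg : ∀ {n} (f : Fin n → ℝ) → ∑ (λ i → - f i) ≡ - ∑ f
  ∑-neg f = trans (∑-cong (λ i → solve 1 (λ x → :- x := (:- :1) :* x) refl (f i)))
                  (trans (∑-*ˡ (- 1r) f) (solve 1 (λ x → (:- :1) :* x := :- x) refl (∑ f)))

  ∑-sub : ∀ {n} (f g : Fin n → ℝ) → ∑ (λ i → f i - g i) ≡ ∑ f - ∑ g
  ∑-sub f g = trans (∑-+ f (λ i → - g i)) (cong (∑ f +_) (∑-neg g))

  ∑-comm : ∀ {n m} (f : Fin n → Fin m → ℝ) → ∑ (λ i → ∑ (f i)) ≡ ∑ (λ j → ∑ (λ i → f i j))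
  ∑-comm {zero} {m} f = sym (∑-zero {m} (λ _ → refl))
  ∑-comm {suc n} f = trans (cong (∑ (f zero) +_) (∑-comm (λ i → f (suc i))))
    (sym (∑-+ (f zero) (λ j → ∑ (λ i → f (suc i) j))))

  ∑-*-comm : ∀ {n m} (μ : Fin n → ℝ) (β : Fin n → Fin m → ℝ) (Y : Fin m → ℝ) →
    ∑ (λ k → μ k * ∑ (λ i → β k i * Y i)) ≡ ∑ (λ i → ∑ (λ k → μ k * β k i) * Y i)
  ∑-*-comm μ β Y = begin
    ∑ (λ k → μ k * ∑ (λ i → β k i * Y i))    ≡⟨ ∑-cong (λ k → sym (∑-*ˡ (μ k) (λ i → β k i * Y i))) ⟩
    ∑ (λ k → ∑ (λ i → μ k * (β k i * Y i)))  ≡⟨ ∑-comm (λ k i → μ k * (β k i * Y i)) ⟩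
    ∑ (λ i → ∑ (λ k → μ k * (β k i * Y i)))  ≡⟨ ∑-cong (λ i → ∑-cong (λ k → sym (*-assoc (μ k) (β k i) (Y i)))) ⟩
    ∑ (λ i → ∑ (λ k → μ k * β k i * Y i))    ≡⟨ ∑-cong (λ i → ∑-*ʳ (Y i) (λ k → μ k * β k i)) ⟩
    ∑ (λ i → ∑ (λ k → μ k * β k i) * Y i)    ∎
    where open ≡-Reasoning

  ∑-nonNeg : ∀ {n} {f : Fin n → ℝ} → (∀ i → 0r ≤ f i) → 0r ≤ ∑ f
  ∑-nonNeg {zero} 0≤f = ≤-refl
  ∑-nonNeg {suc n} 0≤f = +-nonNeg (0≤f zero) (∑-nonNeg (λ i → 0≤f (suc i)))

  ∑-mono-≤ : ∀ {n} {f g : Fin n → ℝ} → (∀ i → f i ≤ g i) → ∑ f ≤ ∑ g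
  ∑-mono-≤ {zero} f≤g = ≤-refl
  ∑-mono-≤ {suc n} f≤g = +-mono-≤ (f≤g zero) (∑-mono-≤ (λ i → f≤g (suc i)))

  ∑-punchIn : ∀ {n} (a : Fin (suc n)) (f : Fin (suc n) → ℝ) → ∑ f ≡ f a + ∑ (λ j → f (punchIn a j))
  ∑-punchIn zero f = refl
  ∑-punchIn {suc n} (suc a) f = trans (cong (f zero +_) (∑-punchIn a (λ i → f (suc i))))
    (solve 3 (λ x y z → x :+ (y :+ z) := y :+ (x :+ z)) refl (f zero) (f (suc a)) _)

  ≤-∑ : ∀ {n} {f : Fin n → ℝ} → (∀ i → 0r ≤ f i) → ∀ j → f j ≤ ∑ f
  ≤-∑ {suc n} {f} 0≤f j = subst (f j ≤_) (sym (∑-punchIn j f))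
    (subst (_≤ f j + ∑ (λ k → f (punchIn j k))) (+-identityʳ (f j)) (+-monoʳ-≤ (f j) (∑-nonNeg (λ k → 0≤f (punchIn j k)))))

  δ : ∀ {n} → Fin n → Fin n → ℝ
  δ a b with a Fin.≟ b
  ... | yes _ = 1r
  ... | no _ = 0r

  δ-diag : ∀ {n} (a : Fin n) → δ a a ≡ 1r
  δ-diag a with a Fin.≟ a
  ... | yes _ = refl
  ... | no a≢a = ⊥-elim (a≢a refl)

  δ-offDiag : ∀ {n} {a b : Fin n} → a ≢ b → δ a b ≡ 0r
  δ-offDiag {a = a} {b} a≢b with a Fin.≟ b
  ... | yes a≡b = ⊥-elim (a≢b a≡b)
  ... | no _ = refl

  δ-sym : ∀ {n} (a b : Fin n) → δ a b ≡ δ b a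
  δ-sym a b with a Fin.≟ b
  ... | yes refl = sym (δ-diag a)
  ... | no a≢b = sym (δ-offDiag (λ b≡a → a≢b (sym b≡a)))

  δ-nonNeg : ∀ {n} (a b : Fin n) → 0r ≤ δ a b
  δ-nonNeg a b with a Fin.≟ b
  ... | yes _ = inj₁ 0<1
  ... | no _ = ≤-refl

  δ-≤1 : ∀ {n} (a b : Fin n) → δ a b ≤ 1r
  δ-≤1 a b with a Fin.≟ b
  ... | yes _ = ≤-refl
  ... | no _ = inj₁ 0<1

  ∑-δ : ∀ {n} (a : Fin n) (f : Fin n → ℝ) → ∑ (λ i → δ a i * f i) ≡ f a
  ∑-δ {suc n} a f = begin
    ∑ (λ i → δ a i * f i)                                     ≡⟨ ∑-punchIn a (λ i → δ a i * f i) ⟩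
    δ a a * f a + ∑ (λ j → δ a (punchIn a j) * f (punchIn a j)) ≡⟨ cong₂ _+_ (cong (_* f a) (δ-diag a)) (∑-zero off) ⟩
    1r * f a + 0r                                             ≡⟨ solve 1 (λ x → :1 :* x :+ :0 := x) refl (f a) ⟩
    f a                                                       ∎
    where
    open ≡-Reasoning
    off : ∀ j → δ a (punchIn a j) * f (punchIn a j) ≡ 0r
    off j = trans (cong (_* f (punchIn a j)) (δ-offDiag (λ a≡ → Fin.punchInᵢ≢i a j (sym a≡)))) (zeroˡ _)

  ∑-δʳ : ∀ {n} (a : Fin n) (f : Fin n → ℝ) → ∑ (λ i → f i * δ i a) ≡ f a
  ∑-δʳ a f = trans (∑-cong (λ i → trans (*-comm (f i) (δ i a)) (cong (_* f i) (δ-sym i a)))) (∑-δ a f)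

  ∑≡0⇒≡0 : ∀ {n} {f : Fin n → ℝ} → (∀ i → f i ≤ 0r) → ∑ f ≡ 0r → ∀ j → f j ≡ 0r
  ∑≡0⇒≡0 {f = f} f≤0 ∑f≡0 j = ≤-antisym (f≤0 j) (subst₂ _≤_ -0≡0 (solve 1 (λ x → :- (:- x) := x) refl (f j))
    (-‿antimono-≤ (subst (- f j ≤_) (trans (∑-neg f) (trans (cong -_ ∑f≡0) -0≡0)) (≤-∑ 0≤-f j))))
    where
    0≤-f : ∀ i → 0r ≤ - f i
    0≤-f i = subst (_≤ - f i) -0≡0 (-‿antimono-≤ (f≤0 i))

  nonZero⇒positive : ∀ {n} {l : Fin n → ℝ} → (∀ j → 0r ≤ l j) → ¬ (∃[ j ] l j ≡ 0r) → ∀ j → 0r < l j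
  nonZero⇒positive 0≤l ¬zero j with 0≤l j
  ... | inj₁ 0<lj = 0<lj
  ... | inj₂ 0≡lj = ⊥-elim (¬zero (j , sym 0≡lj))

  argmin : ∀ {r} (P : Fin r → Set) → (∀ j → Dec (P j)) → (f : Fin r → ℝ) → ∃[ j ] P j →
    ∃[ a ] (P a × (∀ j → P j → f a ≤ f j))
  argmin {suc r} P P? f (j , Pj) with P? zero | Fin.any? (λ j → P? (suc j))
  ... | yes P₀ | no ¬P₊ = zero , P₀ , λ { zero _ → ≤-refl ; (suc j) Pj → ⊥-elim (¬P₊ (j , Pj)) }
  ... | no ¬P₀ | no ¬P₊ = ⊥-elim (case j Pj)
    where
    case : ∀ j → P j → ⊥
    case zero P₀ = ¬P₀ P₀
    case (suc j) Pj = ¬P₊ (j , Pj)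
  ... | no ¬P₀ | yes P₊ with argmin (λ j → P (suc j)) (λ j → P? (suc j)) (λ j → f (suc j)) P₊
  ...   | a , Pa , min = suc a , Pa , λ { zero P₀ → ⊥-elim (¬P₀ P₀) ; (suc j) Pj → min j Pj }
  argmin {suc r} P P? f _ | yes P₀ | yes P₊ with argmin (λ j → P (suc j)) (λ j → P? (suc j)) (λ j → f (suc j)) P₊
  ... | a , Pa , min with ≤⊎> (f zero) (f (suc a))
  ...   | inj₁ f₀≤ = zero , P₀ , λ { zero _ → ≤-refl ; (suc j) Pj → ≤-trans f₀≤ (min j Pj) }
  ...   | inj₂ f₊< = suc a , Pa , λ { zero _ → inj₁ f₊< ; (suc j) Pj → min j Pj }

  mixture : ∀ {r} (a b : ℝ) (u v : Fin r → ℝ) → Fin r → ℝ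
  mixture a b u v i = (a * u i + b * v i) / (a + b)

  ∑-mixture : ∀ {r} a b (u v Y : Fin r → ℝ) →
    ∑ (λ i → mixture a b u v i * Y i) ≡ (a * ∑ (λ i → u i * Y i) + b * ∑ (λ i → v i * Y i)) / (a + b)
  ∑-mixture a b u v Y = begin
    ∑ (λ i → (a * u i + b * v i) * (a + b) ⁻¹ * Y i)           ≡⟨ ∑-cong (λ i → solve 6 (λ a b u v w y → (a :* u :+ b :* v) :* w :* y := (a :* (u :* y) :+ b :* (v :* y)) :* w) refl a b (u i) (v i) ((a + b) ⁻¹) (Y i)) ⟩
    ∑ (λ i → (a * (u i * Y i) + b * (v i * Y i)) * (a + b) ⁻¹) ≡⟨ ∑-*ʳ ((a + b) ⁻¹) (λ i → a * (u i * Y i) + b * (v i * Y i)) ⟩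
    ∑ (λ i → a * (u i * Y i) + b * (v i * Y i)) / (a + b)      ≡⟨ cong (_/ (a + b)) (∑-+ (λ i → a * (u i * Y i)) (λ i → b * (v i * Y i))) ⟩
    (∑ (λ i → a * (u i * Y i)) + ∑ (λ i → b * (v i * Y i))) / (a + b) ≡⟨ cong (_/ (a + b)) (cong₂ _+_ (∑-*ˡ a (λ i → u i * Y i)) (∑-*ˡ b (λ i → v i * Y i))) ⟩
    (a * ∑ (λ i → u i * Y i) + b * ∑ (λ i → v i * Y i)) / (a + b) ∎
    where open ≡-Reasoning

  pushforward : ∀ {r n} → (Fin r → Fin n) → (Fin r → ℝ) → Fin n → ℝ
  pushforward g l i = ∑ (λ j → l j * δ (g j) i)

  ∑-pushforward : ∀ {r n} (g : Fin r → Fin n) (l : Fin r → ℝ) (X : Fin n → ℝ) →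
    ∑ (λ i → pushforward g l i * X i) ≡ ∑ (λ j → l j * X (g j))
  ∑-pushforward g l X = begin
    ∑ (λ i → ∑ (λ j → l j * δ (g j) i) * X i)      ≡⟨ ∑-cong (λ i → sym (∑-*ʳ (X i) (λ j → l j * δ (g j) i))) ⟩
    ∑ (λ i → ∑ (λ j → l j * δ (g j) i * X i))      ≡⟨ ∑-comm (λ i j → l j * δ (g j) i * X i) ⟩
    ∑ (λ j → ∑ (λ i → l j * δ (g j) i * X i))      ≡⟨ ∑-cong (λ j → ∑-cong (λ i → *-assoc (l j) (δ (g j) i) (X i))) ⟩
    ∑ (λ j → ∑ (λ i → l j * (δ (g j) i * X i)))    ≡⟨ ∑-cong (λ j → ∑-*ˡ (l j) (λ i → δ (g j) i * X i)) ⟩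
    ∑ (λ j → l j * ∑ (λ i → δ (g j) i * X i))      ≡⟨ ∑-cong (λ j → cong (l j *_) (∑-δ (g j) X)) ⟩
    ∑ (λ j → l j * X (g j))                        ∎
    where open ≡-Reasoning

  ∑pushforward : ∀ {r n} (g : Fin r → Fin n) (l : Fin r → ℝ) → ∑ (pushforward g l) ≡ ∑ l
  ∑pushforward g l = trans (∑-cong (λ i → sym (*-identityʳ (pushforward g l i))))
    (trans (∑-pushforward g l (λ _ → 1r)) (∑-cong (λ j → *-identityʳ (l j))))

  pushforward-nonNeg : ∀ {r n} (g : Fin r → Fin n) {l : Fin r → ℝ} → (∀ j → 0r ≤ l j) →
    ∀ i → 0r ≤ pushforward g l i
  pushforward-nonNeg g 0≤l i = ∑-nonNeg (λ j → *-nonNeg (0≤l j) (δ-nonNeg (g j) i))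

  pushforward-outside : ∀ {r n} (g : Fin r → Fin n) (l : Fin r → ℝ) {i} → (∀ j → g j ≢ i) →
    pushforward g l i ≡ 0r
  pushforward-outside g l g≢i = ∑-zero (λ j → trans (cong (l _ *_) (δ-offDiag (g≢i j))) (zeroʳ _))

module LinearAlgebra (R : RealField) where
  open import Data.Nat as ℕ using (zero; s≤s)
  import Data.Nat.Properties as ℕ
  open import Data.Fin as Fin using (zero; suc; punchIn)
  import Data.Fin.Properties as Fin
  open import Data.Vec.Functional using (insertAt; _∷_)
  open import Data.Vec.Functional.Properties using (insertAt-lookup; insertAt-punchIn)
  open import Data.Product using (proj₁; proj₂; ∃-syntax)
  open import Data.Empty using (⊥-elim)
  open import Relation.Nullary using (¬_; Dec; yes; no; ¬?)

  open Sums R public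
  open FinMaps

  NonTrivial : ∀ {n} → (Fin n → ℝ) → Set
  NonTrivial μ = ∃[ j ] μ j ≢ 0r

  ∑-insertAt : ∀ {n} (g : Fin n → ℝ) a x (f : Fin (suc n) → ℝ) →
    ∑ (λ i → insertAt g a x i * f i) ≡ x * f a + ∑ (λ j → g j * f (punchIn a j))
  ∑-insertAt g a x f = trans (∑-punchIn a (λ i → insertAt g a x i * f i))
    (cong₂ _+_ (cong (_* f a) (insertAt-lookup g a x))
               (∑-cong (λ j → cong (_* f (punchIn a j)) (insertAt-punchIn g a x j))))

  π-h-≈ : ∀ {m} {x y : Pt (suc m)} → π x ≈ π y → h x ≡ h y → x ≈ y
  π-h-≈ πx≈πy hx≡hy l with inject₁⊎fromℕ l
  ... | inj₁ (l′ , refl) = πx≈πy l′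
  ... | inj₂ refl = hx≡hy

  -- Gaussian elimination on the first coordinate: either it vanishes on every vector,
  -- or a pivot vector is used to clear it from all others.
  linearDependence : ∀ {r s} → r ℕ.≤ s → (v : Fin (suc s) → Fin r → ℝ) →
    ∃[ μ ] (NonTrivial μ × (∀ k → ∑ (λ j → μ j * v j k) ≡ 0r))
  linearDependence {zero} _ v = (λ _ → 1r) , (zero , λ 1≡0 → 0≢1 (sym 1≡0)) , λ ()
  linearDependence {suc r} {suc s} (s≤s r≤s) v with Fin.any? (λ a → ¬? (v a zero ≟ 0r))
  ... | no no-pivot = (0r ∷ μ) , (suc j , μj≢0) , combination
    where
    v·0≡0 : ∀ a → v a zero ≡ 0r
    v·0≡0 a with v a zero ≟ 0r
    ... | yes va≡0 = va≡0
    ... | no va≢0 = ⊥-elim (no-pivot (a , va≢0))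
    IH = linearDependence r≤s (λ j k → v (suc j) (suc k))
    μ = proj₁ IH
    j = proj₁ (proj₁ (proj₂ IH))
    μj≢0 = proj₂ (proj₁ (proj₂ IH))
    combination : ∀ k → ∑ (λ j → (0r ∷ μ) j * v j k) ≡ 0r
    combination zero = ∑-zero (λ j → trans (cong ((0r ∷ μ) j *_) (v·0≡0 j)) (zeroʳ _))
    combination (suc k) = trans (cong (_+ ∑ (λ j → μ j * v (suc j) (suc k))) (zeroˡ _)) (trans (+-identityˡ _) (proj₂ (proj₂ IH) k))
  ... | yes (a , va≢0) = insertAt μ a (- S) , (punchIn a j , μj≢0′) , combination
    where
    va = v a zero
    t : Fin (suc s) → ℝ
    t j = v (punchIn a j) zero / va
    w : Fin (suc s) → Fin r → ℝ
    w j k = v (punchIn a j) (suc k) - t j * v a (suc k)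
    IH = linearDependence r≤s w
    μ = proj₁ IH
    j = proj₁ (proj₁ (proj₂ IH))
    S = ∑ (λ j → μ j * t j)
    μj≢0′ = subst (_≢ 0r) (sym (insertAt-punchIn μ a (- S) j)) (proj₂ (proj₁ (proj₂ IH)))
    combination : ∀ k → ∑ (λ j → insertAt μ a (- S) j * v j k) ≡ 0r
    combination zero = trans (∑-insertAt μ a (- S) (λ i → v i zero))
      (trans (cong (- S * va +_) (trans (∑-cong (λ j → trans (cong (μ j *_) (sym (/-*-cancel _ va≢0)))
                                                             (sym (*-assoc (μ j) (t j) va))))
                                    (∑-*ʳ va (λ j → μ j * t j))))
      (solve 2 (λ S v → (:- S) :* v :+ S :* v := :0) refl S va))
    combination (suc k) = begin
      ∑ (λ j → insertAt μ a (- S) j * v j (suc k))    ≡⟨ ∑-insertAt μ a (- S) (λ i → v i (suc k)) ⟩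
      - S * vk + X                                    ≡⟨ sym eliminated ⟩
      ∑ (λ j → μ j * w j k)                            ≡⟨ proj₂ (proj₂ IH) k ⟩
      0r                                              ∎
      where
      open ≡-Reasoning
      vk = v a (suc k)
      X = ∑ (λ j → μ j * v (punchIn a j) (suc k))
      eliminated : ∑ (λ j → μ j * w j k) ≡ - S * vk + X
      eliminated = trans (∑-cong (λ j → solve 4 (λ m x t y → m :* (x :- t :* y) := m :* x :- (m :* t) :* y) refl
                                          (μ j) (v (punchIn a j) (suc k)) (t j) vk))
        (trans (∑-sub (λ j → μ j * v (punchIn a j) (suc k)) (λ j → μ j * t j * vk))
        (trans (cong (λ y → X - y) (∑-*ʳ vk (λ j → μ j * t j)))
        (solve 3 (λ X S v → X :- S :* v := (:- S) :* v :+ X) refl X S vk)))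

  affineDependence : ∀ {m s} → suc m ℕ.≤ s → (x : Fin (suc s) → Pt m) →
    ∃[ μ ] (NonTrivial μ × ∑ μ ≡ 0r × lin μ x ≈ 0v)
  affineDependence m<s x with linearDependence m<s (λ j → 1r ∷ x j)
  ... | μ , nonTrivial , combination =
    μ , nonTrivial , trans (∑-cong (λ j → sym (*-identityʳ (μ j)))) (combination zero) , λ k → combination (suc k)

  -- Homogenise u with a 0 and the x j with a 1: a linear dependence among these m + 2 vectors
  -- of ℝ^(m+1) expresses u through the x j, since the coefficient of u cannot vanish.
  affIndep⇒spanDirections : ∀ {m} (x : Fin (suc m) → Pt m) → AffIndep x → (u : Pt m) →
    ∃[ w ] (∑ w ≡ 0r × lin w x ≈ u)
  affIndep⇒spanDirections {m} x indep u
    with linearDependence ℕ.≤-refl ((0r ∷ u) ∷ (λ j → 1r ∷ x j))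
  ... | μ , (j , μj≢0) , combination = solveFor (μ zero ≟ 0r)
    where
    ν : Fin (suc m) → ℝ
    ν j = μ (suc j)
    ∑ν≡0 : ∑ ν ≡ 0r
    ∑ν≡0 = trans (solve 2 (λ a s → s := a :* :0 :+ s) refl (μ zero) (∑ ν))
                 (trans (cong (μ zero * 0r +_) (∑-cong (λ j → sym (*-identityʳ (ν j))))) (combination zero))
    relation : ∀ k → μ zero * u k + lin ν x k ≡ 0r
    relation k = combination (suc k)
    solveFor : Dec (μ zero ≡ 0r) → ∃[ w ] (∑ w ≡ 0r × lin w x ≈ u)
    solveFor (yes μ₀≡0) = ⊥-elim (μj≢0 (μ≡0 j))
      where
      νx≡0 : lin ν x ≈ 0v
      νx≡0 k = trans (solve 2 (λ y u → y := :0 :* u :+ y) refl (lin ν x k) (u k))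
                     (trans (cong (λ a → a * u k + lin ν x k) (sym μ₀≡0)) (relation k))
      μ≡0 : ∀ j → μ j ≡ 0r
      μ≡0 zero = μ₀≡0
      μ≡0 (suc j) = indep ν ∑ν≡0 νx≡0 j
    solveFor (no μ₀≢0) = w , ∑w≡0 , wx≡u
      where
      w : Fin (suc m) → ℝ
      w j = - (ν j / μ zero)
      ∑w≡0 : ∑ w ≡ 0r
      ∑w≡0 = trans (∑-neg (λ j → ν j / μ zero))
        (trans (cong -_ (trans (∑-*ʳ (μ zero ⁻¹) ν) (trans (cong (_/ μ zero) ∑ν≡0) (zeroˡ _)))) -0≡0)
      wx≡u : lin w x ≈ u
      wx≡u k = begin
        ∑ (λ j → - (ν j / μ zero) * x j k)  ≡⟨ ∑-cong (λ j → solve 3 (λ a b c → (:- (a :* b)) :* c := (:- b) :* (a :* c)) refl (ν j) (μ zero ⁻¹) (x j k)) ⟩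
        ∑ (λ j → - μ zero ⁻¹ * (ν j * x j k)) ≡⟨ ∑-*ˡ (- μ zero ⁻¹) (λ j → ν j * x j k) ⟩
        - μ zero ⁻¹ * lin ν x k              ≡⟨ cong (- μ zero ⁻¹ *_) (-‿unique (μ zero * u k) (lin ν x k) (relation k)) ⟩
        - μ zero ⁻¹ * - (μ zero * u k)       ≡⟨ solve 3 (λ i m u → (:- i) :* (:- (m :* u)) := (m :* i) :* u) refl (μ zero ⁻¹) (μ zero) (u k) ⟩
        μ zero * μ zero ⁻¹ * u k             ≡⟨ cong (_* u k) (*-inverseʳ μ₀≢0) ⟩
        1r * u k                             ≡⟨ *-identityˡ (u k) ⟩
        u k                                  ∎
        where open ≡-Reasoning

  module _ {r m} (xs : Fin r → Pt m) (W : Fin m → Fin r → ℝ)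
           (∑W≡0 : ∀ k → ∑ (W k) ≡ 0r) (Wxs≡δ : ∀ k → lin (W k) xs ≈ δ k) where

    displace : (Fin r → ℝ) → Pt m → Fin r → ℝ
    displace c d j = c j + ∑ (λ k → d k * W k j)

    ∑displace : ∀ c d → ∑ (displace c d) ≡ ∑ c
    ∑displace c d = begin
      ∑ (λ j → c j + ∑ (λ k → d k * W k j))       ≡⟨ ∑-+ c _ ⟩
      ∑ c + ∑ (λ j → ∑ (λ k → d k * W k j))       ≡⟨ cong (∑ c +_) (∑-comm (λ j k → d k * W k j)) ⟩
      ∑ c + ∑ (λ k → ∑ (λ j → d k * W k j))       ≡⟨ cong (∑ c +_) (∑-zero (λ k → trans (∑-*ˡ (d k) (W k)) (trans (cong (d k *_) (∑W≡0 k)) (zeroʳ (d k))))) ⟩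
      ∑ c + 0r                                    ≡⟨ +-identityʳ (∑ c) ⟩
      ∑ c                                         ∎
      where open ≡-Reasoning

    lin-displace : ∀ c d l → lin (displace c d) xs l ≡ lin c xs l + d l
    lin-displace c d l = begin
      ∑ (λ j → (c j + D j) * xs j l)                 ≡⟨ ∑-cong (λ j → distribʳ (xs j l) (c j) (D j)) ⟩
      ∑ (λ j → c j * xs j l + D j * xs j l)          ≡⟨ ∑-+ (λ j → c j * xs j l) (λ j → D j * xs j l) ⟩
      lin c xs l + ∑ (λ j → D j * xs j l)            ≡⟨ cong (lin c xs l +_) moved ⟩
      lin c xs l + d l                               ∎
      where
      open ≡-Reasoning
      D = λ j → ∑ (λ k → d k * W k j)
      moved : ∑ (λ j → D j * xs j l) ≡ d l
      moved = begin
        ∑ (λ j → D j * xs j l)                       ≡⟨ ∑-cong (λ j → sym (∑-*ʳ (xs j l) (λ k → d k * W k j))) ⟩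
        ∑ (λ j → ∑ (λ k → d k * W k j * xs j l))     ≡⟨ ∑-comm (λ j k → d k * W k j * xs j l) ⟩
        ∑ (λ k → ∑ (λ j → d k * W k j * xs j l))     ≡⟨ ∑-cong (λ k → trans (∑-cong (λ j → *-assoc (d k) (W k j) (xs j l))) (∑-*ˡ (d k) (λ j → W k j * xs j l))) ⟩
        ∑ (λ k → d k * lin (W k) xs l)               ≡⟨ ∑-cong (λ k → cong (d k *_) (Wxs≡δ k l)) ⟩
        ∑ (λ k → d k * δ k l)                        ≡⟨ ∑-δʳ l d ⟩
        d l                                          ∎

  inConv₀⇒inConv : ∀ {N m} {X : Fin N → Pt m} {S y} → InConv₀ X S y → InConv X S y
  inConv₀⇒inConv {y = y} (ε , 0<ε , box) = box y (λ k → y-ε<y k , y<y+ε k)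
    where
    y-ε<y : ∀ k → y k - ε < y k
    y-ε<y k = subst (y k - ε <_) (+-identityʳ (y k)) (+-monoʳ-< (y k) (subst (- ε <_) -0≡0 (-‿antimono-< 0<ε)))
    y<y+ε : ∀ k → y k < y k + ε
    y<y+ε k = subst (_< y k + ε) (+-identityʳ (y k)) (+-monoʳ-< (y k) 0<ε)

  -- The points y + η eₖ of the box give m differences of convex combinations equal to η eₖ;
  -- with at most m points, their weight vectors (summing to 0, so determined by N - 1 entries)
  -- are linearly dependent, and so would be the η eₖ.
  interior⇒dimension≤ : ∀ {N m} (X : Fin N → Pt m) {S y} → InConv₀ X S y → suc m ℕ.≤ N
  interior⇒dimension≤ {zero} X y∈conv₀ with inConv₀⇒inConv {X = X} y∈conv₀
  ... | _ , _ , _ , ∑α≡1 , _ = ⊥-elim (0≢1 ∑α≡1)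
  interior⇒dimension≤ {suc n} {zero} X _ = s≤s ℕ.z≤n
  interior⇒dimension≤ {suc n} {suc m} X {S} {y} y∈conv₀@(ε , 0<ε , box) with suc m ℕ.≤? n
  ... | yes m<n = s≤s m<n
  ... | no m≮n = ⊥-elim (μl≢0 (a*b≡0⇒a≡0 0<η (trans (sym (∑μηδ≡μη l)) (∑μηδ≡0 l))))
    where
    dense = 0<-dense 0<ε
    η = proj₁ dense
    0<η = proj₁ (proj₂ dense)
    z : Fin (suc m) → Pt (suc m)
    z k l = y l + η * δ k l
    z∈box : ∀ k l → y l - ε < z k l × z k l < y l + ε
    z∈box k l = <-≤-trans (+-monoʳ-< (y l) (subst (- ε <_) -0≡0 (-‿antimono-< 0<ε)))
                          (+-monoʳ-≤ (y l) (subst (_≤ η * δ k l) (zeroʳ η) (*-monoʳ-≤-nonNeg (inj₁ 0<η) (δ-nonNeg k l))))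
              , +-monoʳ-< (y l) (≤-<-trans (subst (η * δ k l ≤_) (*-identityʳ η) (*-monoʳ-≤-nonNeg (inj₁ 0<η) (δ-≤1 k l)))
                                          (proj₂ (proj₂ dense)))
    y∈conv = inConv₀⇒inConv {X = X} y∈conv₀
    α₀ = proj₁ y∈conv
    α : Fin (suc m) → Fin (suc n) → ℝ
    α k = proj₁ (box (z k) (z∈box k))
    β : Fin (suc m) → Fin (suc n) → ℝ
    β k i = α k i - α₀ i
    ∑β≡0 : ∀ k → ∑ (β k) ≡ 0r
    ∑β≡0 k = trans (∑-sub (α k) α₀) (trans (cong₂ _-_ (proj₁ (proj₂ (proj₂ (proj₂ (box (z k) (z∈box k))))))
                                                   (proj₁ (proj₂ (proj₂ (proj₂ y∈conv)))))
                                          (-‿inverseʳ 1r))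
    βX≡ηδ : ∀ k l → lin (β k) X l ≡ η * δ k l
    βX≡ηδ k l = trans (∑-cong (λ i → solve 3 (λ a b x → (a :- b) :* x := a :* x :- b :* x) refl (α k i) (α₀ i) (X i l)))
      (trans (∑-sub (λ i → α k i * X i l) (λ i → α₀ i * X i l))
      (trans (cong₂ _-_ (proj₂ (proj₂ (proj₂ (proj₂ (box (z k) (z∈box k))))) l)
                        (proj₂ (proj₂ (proj₂ (proj₂ y∈conv))) l))
      (solve 2 (λ y e → y :+ e :- y := e) refl (y l) (η * δ k l))))
    dependence = linearDependence (ℕ.≮⇒≥ m≮n) (λ k i → β k (suc i))
    μ = proj₁ dependence
    l = proj₁ (proj₁ (proj₂ dependence))
    μl≢0 = proj₂ (proj₁ (proj₂ dependence))
    ∑μβ≡0 : ∀ i → ∑ (λ k → μ k * β k i) ≡ 0r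
    ∑μβ≡0 (suc i) = proj₂ (proj₂ dependence) i
    ∑μβ≡0 zero = begin
      column                                                       ≡⟨ solve 1 (λ a → a := a :* :1 :+ :0) refl column ⟩
      column * 1r + 0r                                             ≡⟨ cong (column * 1r +_) (sym (∑-zero {n} (λ i → zeroˡ 1r))) ⟩
      column * 1r + ∑ {n} (λ i → 0r * 1r)                          ≡⟨ cong (column * 1r +_) (∑-cong (λ i → cong (_* 1r) (sym (∑μβ≡0 (suc i))))) ⟩
      ∑ (λ i → ∑ (λ k → μ k * β k i) * 1r)                         ≡⟨ sym (∑-*-comm μ β (λ _ → 1r)) ⟩
      ∑ (λ k → μ k * ∑ (λ i → β k i * 1r))                         ≡⟨ ∑-zero (λ k → trans (cong (μ k *_) (trans (∑-cong (λ i → *-identityʳ (β k i))) (∑β≡0 k))) (zeroʳ (μ k))) ⟩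
      0r                                                           ∎
      where
      open ≡-Reasoning
      column = ∑ (λ k → μ k * β k zero)
    ∑μηδ≡μη : ∀ l → ∑ (λ k → μ k * (η * δ k l)) ≡ μ l * η
    ∑μηδ≡μη l = trans (∑-cong (λ k → sym (*-assoc (μ k) η (δ k l)))) (∑-δʳ l (λ k → μ k * η))
    ∑μηδ≡0 : ∀ l → ∑ (λ k → μ k * (η * δ k l)) ≡ 0r
    ∑μηδ≡0 l = begin
      ∑ (λ k → μ k * (η * δ k l))                  ≡⟨ ∑-cong (λ k → cong (μ k *_) (sym (βX≡ηδ k l))) ⟩
      ∑ (λ k → μ k * ∑ (λ i → β k i * X i l))      ≡⟨ ∑-*-comm μ β (λ i → X i l) ⟩
      ∑ (λ i → ∑ (λ k → μ k * β k i) * X i l)      ≡⟨ ∑-zero (λ i → trans (cong (_* X i l) (∑μβ≡0 i)) (zeroˡ (X i l))) ⟩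
      0r                                           ∎
      where open ≡-Reasoning

module ConvexGeometry (R : RealField) {N m : ℕ} (X : Fin N → Geometry.Pt R m) where
  open import Data.Nat as ℕ using (zero; s≤s)
  import Data.Nat.Properties as ℕ
  open import Data.Vec.Functional using (_∷_)
  open import Data.Fin as Fin using (zero; suc; punchIn)
  import Data.Fin.Properties as Fin
  open import Data.Fin.Subset.Properties using (∈⊤)
  open import Data.Product using (proj₁; proj₂; ∃-syntax)
  open import Data.Empty using (⊥; ⊥-elim)
  open import Relation.Nullary using (¬_; yes; no; ¬?)
  open import Relation.Nullary.Decidable using (_×-dec_)
  open import Function.Bundles using (_⇔_; mk⇔)
  open import Relation.Binary.Definitions using (tri<; tri≈; tri>)
  open import Function.Definitions using (Injective)

  open LinearAlgebra R
  open FinMaps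

  InOpenSimplex : Fin N → (Fin (suc m) → Fin N) → (Fin (suc m) → ℝ) → Set
  InOpenSimplex p ps c = Injective _≡_ _≡_ ps × (∀ j → ps j ≢ p) × (∀ j → 0r < c j × c j < 1r) ×
    ∑ c ≡ 1r × X p ≈ lin c (λ j → X (ps j))

  inConv-pushforward : ∀ {r} (g : Fin r → Fin N) {l : Fin r → ℝ} {y} → (∀ j → 0r ≤ l j) → ∑ l ≡ 1r →
    lin l (λ j → X (g j)) ≈ y → InConv X ⊤ y
  inConv-pushforward g {l} 0≤l ∑l≡1 l·Xg≡y =
    pushforward g l , (λ i i∉⊤ → ⊥-elim (i∉⊤ ∈⊤)) , pushforward-nonNeg g 0≤l , trans (∑pushforward g l) ∑l≡1 ,
    λ k → trans (∑-pushforward g l (λ i → X i k)) (l·Xg≡y k)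

  positiveLowerBound : ∀ {r} (f : Fin r → ℝ) → (∀ j → 0r < f j) → ∃[ ε ] (0r < ε × (∀ j → ε ≤ f j))
  positiveLowerBound {zero} f 0<f = 1r , 0<1 , λ ()
  positiveLowerBound {suc r} f 0<f with positiveLowerBound (λ j → f (suc j)) (λ j → 0<f (suc j))
  ... | ε , 0<ε , ε≤f with ≤⊎> ε (f zero)
  ... | inj₁ ε≤f₀ = ε , 0<ε , λ { zero → ε≤f₀ ; (suc j) → ε≤f j }
  ... | inj₂ f₀<ε = f zero , 0<f zero , λ { zero → ≤-refl ; (suc j) → ≤-trans (inj₁ f₀<ε) (ε≤f j) }

  -- Moving y by d in the box changes the weights by ∑ₖ dₖ Wₖ, where Wₖ expresses the k-th unit vector
  -- through the simplex; the box is chosen so small that the weights stay nonnegative.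
  positiveCombination⇒interior : ∀ (ps : Fin (suc m) → Fin N) {c : Fin (suc m) → ℝ} {y} →
    AffIndep (λ j → X (ps j)) → (∀ j → 0r < c j) → ∑ c ≡ 1r → lin c (λ j → X (ps j)) ≈ y →
    InConv₀ X ⊤ y
  positiveCombination⇒interior ps {c} {y} indep 0<c ∑c≡1 c·xs≡y = ε , 0<ε , inBox
    where
    xs = λ j → X (ps j)
    directions = λ k → affIndep⇒spanDirections xs indep (δ k)
    W : Fin m → Fin (suc m) → ℝ
    W k = proj₁ (directions k)
    ∑W≡0 = λ k → proj₁ (proj₂ (directions k))
    Wxs≡δ = λ k → proj₂ (proj₂ (directions k))
    S : Fin (suc m) → ℝ
    S j = ∑ (λ k → ∣ W k j ∣)
    0<1+S : ∀ j → 0r < 1r + S j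
    0<1+S j = +-pos-nonNeg 0<1 (∑-nonNeg (λ k → proj₁ (∣x∣-bounds (W k j))))
    bound = positiveLowerBound (λ j → c j / (1r + S j)) (λ j → /-pos (0<c j) (0<1+S j))
    ε = proj₁ bound
    0<ε = proj₁ (proj₂ bound)
    εS≤c : ∀ j → ε * S j ≤ c j
    εS≤c j = ≤-trans (*-monoʳ-≤-nonNeg (inj₁ 0<ε) (subst (_≤ 1r + S j) (+-identityˡ (S j)) (+-monoˡ-≤ (S j) (inj₁ 0<1))))
      (subst (ε * (1r + S j) ≤_) (/-*-cancel (c j) (0<⇒≢0 (0<1+S j)))
        (*-monoˡ-≤-nonNeg (inj₁ (0<1+S j)) (proj₂ (proj₂ bound) j)))
    inBox : ∀ z → (∀ k → y k - ε < z k × z k < y k + ε) → InConv X ⊤ z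
    inBox z z∈box = inConv-pushforward ps 0≤λ ∑λ≡1 λ·xs≡z
      where
      d : Pt m
      d k = z k - y k
      λ′ = displace xs W ∑W≡0 Wxs≡δ c d
      ∑λ≡1 = trans (∑displace xs W ∑W≡0 Wxs≡δ c d) ∑c≡1
      λ·xs≡z : lin λ′ xs ≈ z
      λ·xs≡z l = trans (lin-displace xs W ∑W≡0 Wxs≡δ c d l)
        (trans (cong (_+ d l) (c·xs≡y l)) (solve 2 (λ y z → y :+ (z :- y) := z) refl (y l) (z l)))
      -ε<d : ∀ k → - ε < d k
      -ε<d k = subst (_< d k) (solve 2 (λ y e → y :- e :- y := :- e) refl (y k) ε) (+-mono-< (- y k) (proj₁ (z∈box k)))
      d<ε : ∀ k → d k < ε
      d<ε k = subst (d k <_) (solve 2 (λ y e → y :+ e :- y := e) refl (y k) ε) (+-mono-< (- y k) (proj₂ (z∈box k)))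
      0≤λ : ∀ j → 0r ≤ λ′ j
      0≤λ j = subst (_≤ λ′ j) (-‿inverseʳ (c j)) (+-monoʳ-≤ (c j) (≤-trans (-‿antimono-≤ (εS≤c j)) shift≥))
        where
        shift≥ : - (ε * S j) ≤ ∑ (λ k → d k * W k j)
        shift≥ = subst (_≤ ∑ (λ k → d k * W k j))
          (trans (∑-neg (λ k → ε * ∣ W k j ∣)) (cong -_ (∑-*ˡ ε (λ k → ∣ W k j ∣))))
          (∑-mono-≤ (λ k → ∣d∣<ε⇒-ε∣a∣≤d*a (W k j) (-ε<d k) (d<ε k)))


  -- Extending an injective family by unused points with weight 0 reduces to the case of m + 1 points.
  affGenPos⇒affIndep : AffGenPos X ⊤ → suc m ℕ.≤ N → ∀ t {s} → t ℕ.+ s ≡ suc m →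
    (f : Fin s → Fin N) → Injective _≡_ _≡_ f → AffIndep (λ j → X (f j))
  affGenPos⇒affIndep genPos m<N zero refl f f-inj = genPos f f-inj (λ _ → ∈⊤)
  affGenPos⇒affIndep genPos m<N (suc t) {s} t+s≡m f f-inj c ∑c≡0 cX≡0 j =
    affGenPos⇒affIndep genPos m<N t (trans (ℕ.+-suc t s) t+s≡m) (i ∷ f) (∷-injective f-inj f≢i)
      (0r ∷ c) (trans (+-identityˡ (∑ c)) ∑c≡0)
      (λ k → trans (cong (_+ lin c (λ j → X (f j)) k) (zeroˡ _)) (trans (+-identityˡ _) (cX≡0 k))) (suc j)
    where
    s<N : s ℕ.< N
    s<N = ℕ.≤-trans (subst (suc s ℕ.≤_) t+s≡m (s≤s (ℕ.m≤n+m s t))) m<N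
    i = proj₁ (outsideImage s<N f)
    f≢i = proj₂ (outsideImage s<N f)

  ConvexRepresentation : ∀ {r} → Fin N → (Fin r → Fin N) → (Fin r → ℝ) → Set
  ConvexRepresentation p g l =
    (∀ j → 0r ≤ l j) × ∑ l ≡ 1r × lin l (λ j → X (g j)) ≈ X p × (∀ j → g j ≡ p → l j ≡ 0r)

  module Carathéodory (genPos : AffGenPos X ⊤) (m<N : suc m ℕ.≤ N) (0<m : 0 ℕ.< m) (p : Fin N)
    (noSimplex : ¬ (∃[ ps ] ∃[ c ] InOpenSimplex p ps c)) where

    ∑-drop : ∀ {r} (f : Fin (suc r) → ℝ) j {t} → f j ≡ 0r → ∑ f ≡ t → ∑ (λ i → f (punchIn j i)) ≡ t
    ∑-drop f j fj≡0 ∑f≡t =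
      trans (sym (+-identityˡ _)) (trans (cong (_+ ∑ (λ i → f (punchIn j i))) (sym fj≡0)) (trans (sym (∑-punchIn j f)) ∑f≡t))

    dropZero : ∀ {r} {g : Fin (suc r) → Fin N} {l} j → l j ≡ 0r → ConvexRepresentation p g l →
      ConvexRepresentation p (λ i → g (punchIn j i)) (λ i → l (punchIn j i))
    dropZero {g = g} {l} j lj≡0 (0≤l , ∑l≡1 , l·X≡Xp , l-avoids) =
      (λ i → 0≤l (punchIn j i)) , ∑-drop l j lj≡0 ∑l≡1 ,
      (λ k → ∑-drop (λ i → l i * X (g i) k) j (trans (cong (_* X (g j) k) lj≡0) (zeroˡ _)) (l·X≡Xp k)) ,
      (λ i → l-avoids (punchIn j i))

    positive⇒avoids : ∀ {r} {g : Fin r → Fin N} {l} → ConvexRepresentation p g l → (∀ j → 0r < l j) →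
      ∀ j → g j ≢ p
    positive⇒avoids (_ , _ , _ , l-avoids) 0<l j gj≡p = <-irrefl (subst (0r <_) (l-avoids j gj≡p) (0<l j))

    mergeDuplicate : ∀ {r} {g : Fin r → Fin N} {l} {j₁ j₂} → j₁ ≢ j₂ → g j₁ ≡ g j₂ →
      ConvexRepresentation p g l → (∀ j → g j ≢ p) → ∃[ l′ ] (l′ j₂ ≡ 0r × ConvexRepresentation p g l′)
    mergeDuplicate {g = g} {l} {j₁} {j₂} j₁≢j₂ g≡ (0≤l , ∑l≡1 , l·X≡Xp , _) g≢p =
      l′ , l′j₂≡0 , 0≤l′ , ∑l′≡1 , l′·X≡Xp , (λ j gj≡p → ⊥-elim (g≢p j gj≡p))
      where
      a = l j₂
      l′ : Fin _ → ℝ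
      l′ i = l i + δ j₁ i * a - δ j₂ i * a
      l′j₂≡0 : l′ j₂ ≡ 0r
      l′j₂≡0 = trans (cong₂ (λ u v → a + u * a - v * a) (δ-offDiag j₁≢j₂) (δ-diag j₂))
                     (solve 1 (λ a → a :+ :0 :* a :- :1 :* a := :0) refl a)
      0≤l′ : ∀ i → 0r ≤ l′ i
      0≤l′ i with i Fin.≟ j₂
      ... | yes refl = inj₂ (sym l′j₂≡0)
      ... | no i≢j₂ = subst (0r ≤_)
        (trans (solve 3 (λ u d a → u :+ d :* a := u :+ d :* a :- :0 :* a) refl (l i) (δ j₁ i) a)
               (cong (λ v → l i + δ j₁ i * a - v * a) (sym (δ-offDiag (λ j₂≡i → i≢j₂ (sym j₂≡i))))))
        (+-nonNeg (0≤l i) (*-nonNeg (δ-nonNeg j₁ i) (0≤l j₂)))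
      ∑l′≡1 : ∑ l′ ≡ 1r
      ∑l′≡1 = trans (∑-sub (λ i → l i + δ j₁ i * a) (λ i → δ j₂ i * a))
        (trans (cong₂ _-_ (trans (∑-+ l (λ i → δ j₁ i * a)) (cong₂ _+_ ∑l≡1 (∑-δ j₁ (λ _ → a)))) (∑-δ j₂ (λ _ → a)))
        (solve 1 (λ a → :1 :+ a :- a := :1) refl a))
      l′·X≡Xp : lin l′ (λ j → X (g j)) ≈ X p
      l′·X≡Xp k = begin
        ∑ (λ i → (l i + δ j₁ i * a - δ j₂ i * a) * Y i)
          ≡⟨ ∑-cong (λ i → solve 5 (λ u d₁ d₂ y a → (u :+ d₁ :* a :- d₂ :* a) :* y := u :* y :+ d₁ :* (a :* y) :- d₂ :* (a :* y))
                                   refl (l i) (δ j₁ i) (δ j₂ i) (Y i) a) ⟩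
        ∑ (λ i → l i * Y i + δ j₁ i * (a * Y i) - δ j₂ i * (a * Y i))
          ≡⟨ ∑-sub (λ i → l i * Y i + δ j₁ i * (a * Y i)) (λ i → δ j₂ i * (a * Y i)) ⟩
        ∑ (λ i → l i * Y i + δ j₁ i * (a * Y i)) - ∑ (λ i → δ j₂ i * (a * Y i))
          ≡⟨ cong₂ _-_ (trans (∑-+ (λ i → l i * Y i) (λ i → δ j₁ i * (a * Y i))) (cong₂ _+_ (l·X≡Xp k) (∑-δ j₁ (λ i → a * Y i))))
                       (∑-δ j₂ (λ i → a * Y i)) ⟩
        X p k + a * Y j₁ - a * Y j₂
          ≡⟨ cong (λ w → X p k + a * Y j₁ - a * X w k) (sym g≡) ⟩
        X p k + a * Y j₁ - a * Y j₁
          ≡⟨ solve 2 (λ y w → y :+ w :- w := y) refl (X p k) (a * Y j₁) ⟩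
        X p k ∎
        where
        open ≡-Reasoning
        Y : Fin _ → ℝ
        Y i = X (g i) k

    -- An affine dependence μ among more than m + 1 points is subtracted from the weights as far as
    -- possible: the ratio t = l a / μ a is minimal among the positive μ a, so l - t μ stays nonnegative.
    eliminatePoint : ∀ {s} {g : Fin (suc s) → Fin N} {l} → suc m ℕ.≤ s → (∀ j → 0r < l j) →
      ConvexRepresentation p g l → ∃[ l′ ] ∃[ a ] (l′ a ≡ 0r × ConvexRepresentation p g l′)
    eliminatePoint {s} {g} {l} m<s 0<l rep@(0≤l , ∑l≡1 , l·X≡Xp , _)
      with affineDependence m<s (λ j → X (g j))
    ... | μ , (j , μj≢0) , ∑μ≡0 , μ·X≡0
      with Fin.any? (λ j → 0r <? μ j)
    ...   | no ¬0<μ = ⊥-elim (μj≢0 (∑≡0⇒≡0 (λ j → ≮⇒≥ (λ 0<μj → ¬0<μ (j , 0<μj))) ∑μ≡0 j))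
    ...   | yes 0<μ with argmin (λ j → 0r < μ j) (λ j → 0r <? μ j) (λ j → l j / μ j) 0<μ
    ...     | a , 0<μa , minimal =
      l′ , a , l′a≡0 , 0≤l′ , ∑l′≡1 , l′·X≡Xp , (λ j gj≡p → ⊥-elim (positive⇒avoids rep 0<l j gj≡p))
      where
      t = l a / μ a
      l′ : Fin (suc s) → ℝ
      l′ j = l j - t * μ j
      tμ≡l : ∀ {j} → μ j ≢ 0r → l j / μ j * μ j ≡ l j
      tμ≡l μj≢0 = /-*-cancel _ μj≢0
      l′a≡0 : l′ a ≡ 0r
      l′a≡0 = trans (cong (λ v → l a - v) (tμ≡l (0<⇒≢0 0<μa))) (-‿inverseʳ (l a))
      0≤l′ : ∀ j → 0r ≤ l′ j
      0≤l′ j with 0r <? μ j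
      ... | yes 0<μj = x≤y⇒0≤y-x (subst (t * μ j ≤_) (tμ≡l (0<⇒≢0 0<μj)) (*-monoˡ-≤-nonNeg (inj₁ 0<μj) (minimal j 0<μj)))
      ... | no 0≮μj = ≤-trans (0≤l j) (subst (_≤ l′ j) (trans (cong (l j +_) -0≡0) (+-identityʳ (l j)))
          (+-monoʳ-≤ (l j) (-‿antimono-≤ (subst (t * μ j ≤_) (zeroʳ t)
            (*-monoʳ-≤-nonNeg (inj₁ (/-pos (0<l a) 0<μa)) (≮⇒≥ 0≮μj))))))
      ∑l′≡1 : ∑ l′ ≡ 1r
      ∑l′≡1 = trans (∑-sub l (λ j → t * μ j))
        (trans (cong₂ _-_ ∑l≡1 (trans (∑-*ˡ t μ) (trans (cong (t *_) ∑μ≡0) (zeroʳ t))))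
        (solve 0 (:1 :- :0 := :1) refl))
      l′·X≡Xp : lin l′ (λ j → X (g j)) ≈ X p
      l′·X≡Xp k = trans (∑-cong (λ j → solve 4 (λ u t w y → (u :- t :* w) :* y := u :* y :- t :* (w :* y)) refl (l j) t (μ j) (X (g j) k)))
        (trans (∑-sub (λ j → l j * X (g j) k) (λ j → t * (μ j * X (g j) k)))
        (trans (cong₂ _-_ (l·X≡Xp k) (trans (∑-*ˡ t (λ j → μ j * X (g j) k)) (trans (cong (t *_) (μ·X≡0 k)) (zeroʳ t))))
        (solve 1 (λ y → y :- :0 := y) refl (X p k))))

    fewPoints⇒⊥ : ∀ {r} {g : Fin r → Fin N} {l} → r ℕ.< suc m → Injective _≡_ _≡_ g → (∀ j → g j ≢ p) →
      ConvexRepresentation p g l → ⊥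
    fewPoints⇒⊥ {r} {g} {l} r≤m g-inj g≢p (_ , ∑l≡1 , l·X≡Xp , _) =
      -1≢0 (independent (- 1r ∷ l) (trans (cong (- 1r +_) ∑l≡1) (-‿inverseˡ 1r)) dependent zero)
      where
      independent = affGenPos⇒affIndep genPos m<N (suc m ℕ.∸ suc r) (ℕ.m∸n+n≡m r≤m) (p ∷ g) (∷-injective g-inj g≢p)
      dependent : lin (- 1r ∷ l) (λ j → X ((p ∷ g) j)) ≈ 0v
      dependent k = trans (cong (- 1r * X p k +_) (l·X≡Xp k)) (solve 1 (λ y → (:- :1) :* y :+ y := :0) refl (X p k))

    openSimplex : ∀ {g : Fin (suc m) → Fin N} {l} → Injective _≡_ _≡_ g → (∀ j → 0r < l j) →
      ConvexRepresentation p g l → InOpenSimplex p g l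
    openSimplex {g} {l} g-inj 0<l rep@(0≤l , ∑l≡1 , l·X≡Xp , _) =
      g-inj , positive⇒avoids rep 0<l , (λ j → 0<l j , l<1 j) , ∑l≡1 , (λ k → sym (l·X≡Xp k))
      where
      l<1 : ∀ j → l j < 1r
      l<1 j = subst₂ _<_ (+-identityʳ (l j)) (trans (sym (∑-punchIn j l)) ∑l≡1)
        (+-monoʳ-< (l j) (<-≤-trans (0<l (punchIn j other)) (≤-∑ (λ i → 0≤l (punchIn j i)) other)))
        where other = Fin.fromℕ< 0<m

    noRepresentation : ∀ r {g : Fin r → Fin N} {l} → ConvexRepresentation p g l → ⊥
    strictRepresentation⇒⊥ : ∀ r {g : Fin (suc r) → Fin N} {l} → Injective _≡_ _≡_ g → (∀ j → 0r < l j) →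
      ConvexRepresentation p g l → ⊥

    noRepresentation zero (_ , ∑l≡1 , _) = 0≢1 ∑l≡1
    noRepresentation (suc r) {g} {l} rep@(0≤l , _) with Fin.any? (λ j → l j ≟ 0r)
    ... | yes (j , lj≡0) = noRepresentation r (dropZero j lj≡0 rep)
    ... | no ¬zero with Fin.any? (λ i → Fin.any? (λ j → ¬? (i Fin.≟ j) ×-dec (g i Fin.≟ g j)))
    ...   | no ¬duplicate = strictRepresentation⇒⊥ r (noDuplicate⇒injective ¬duplicate) (nonZero⇒positive 0≤l ¬zero) rep
    ...   | yes (i , j , i≢j , gi≡gj)
      with l′ , l′j≡0 , rep′ ← mergeDuplicate i≢j gi≡gj rep (positive⇒avoids rep (nonZero⇒positive 0≤l ¬zero)) =
      noRepresentation r (dropZero j l′j≡0 rep′)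

    strictRepresentation⇒⊥ r {g} {l} g-inj 0<l rep with ℕ.<-cmp (suc r) (suc m)
    ... | tri< r<m _ _ = fewPoints⇒⊥ r<m g-inj (positive⇒avoids rep 0<l) rep
    ... | tri≈ _ refl _ = noSimplex (g , l , openSimplex g-inj 0<l rep)
    ... | tri> _ _ m<r with l′ , a , l′a≡0 , rep′ ← eliminatePoint (ℕ.≤-pred m<r) 0<l rep =
      noRepresentation r (dropZero a l′a≡0 rep′)

  interior⇒extendable : ∀ {S y} → InConv₀ X S y → (w : Pt m) →
    ∃[ η ] (0r < η × InConv X S (λ k → y k + η * (y k - w k)))
  interior⇒extendable {y = y} (ε , 0<ε , box) w = η , 0<η , box z z∈box
    where
    d : Pt m
    d k = y k - w k
    D = ∑ (λ k → ∣ d k ∣)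
    0<1+D : 0r < 1r + D
    0<1+D = +-pos-nonNeg 0<1 (∑-nonNeg (λ k → proj₁ (∣x∣-bounds (d k))))
    η = ε / (1r + D)
    0<η = /-pos 0<ε 0<1+D
    ηD<ε : η * D < ε
    ηD<ε = subst₂ _<_ refl (trans (*-comm η (1r + D)) (trans (*-comm (1r + D) η) (/-*-cancel ε (0<⇒≢0 0<1+D))))
      (*-monoʳ-<-pos 0<η (subst (_< 1r + D) (+-identityˡ D) (+-mono-< D 0<1)))
    z : Pt m
    z k = y k + η * d k
    η∣d∣<ε : ∀ k → η * ∣ d k ∣ < ε
    η∣d∣<ε k = ≤-<-trans (*-monoʳ-≤-nonNeg (inj₁ 0<η) (≤-∑ (λ j → proj₁ (∣x∣-bounds (d j))) k)) ηD<ε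
    z∈box : ∀ k → y k - ε < z k × z k < y k + ε
    z∈box k = +-monoʳ-< (y k) (<-≤-trans (-‿antimono-< (η∣d∣<ε k))
                (subst (- (η * ∣ d k ∣) ≤_) (solve 2 (λ e d → :- (e :* (:- d)) := e :* d) refl η (d k))
                  (-‿antimono-≤ (*-monoʳ-≤-nonNeg (inj₁ 0<η) (proj₂ (proj₂ (∣x∣-bounds (d k))))))))
            , +-monoʳ-< (y k) (≤-<-trans (*-monoʳ-≤-nonNeg (inj₁ 0<η) (proj₁ (proj₂ (∣x∣-bounds (d k))))) (η∣d∣<ε k))

  -- From X p + η (X p - X q) = ∑ αᵢ Xᵢ follows (η + 1 - α p) X p = η X q + ∑_{i ≠ p} αᵢ Xᵢ.
  extension⇒representation : ∀ {p q} → q ≢ p → ∀ {η} → 0r < η →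
    InConv X ⊤ (λ k → X p k + η * (X p k - X q k)) → ∃[ l ] ConvexRepresentation p (q ∷ λ i → i) l
  extension⇒representation {p} {q} q≢p {η} 0<η (α , _ , 0≤α , ∑α≡1 , α·X≡z) =
    l , 0≤l , ∑l≡1 , l·X≡Xp , avoids
    where
    α′ : Fin N → ℝ
    α′ i = α i - δ p i * α i
    α′p≡0 : α′ p ≡ 0r
    α′p≡0 = trans (cong (λ d → α p - d * α p) (δ-diag p)) (solve 1 (λ a → a :- :1 :* a := :0) refl (α p))
    0≤α′ : ∀ i → 0r ≤ α′ i
    0≤α′ i with i Fin.≟ p
    ... | yes refl = inj₂ (sym α′p≡0)
    ... | no i≢p = subst (0r ≤_) (sym (trans (cong (λ d → α i - d * α i) (δ-offDiag (λ p≡i → i≢p (sym p≡i))))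
                                            (solve 1 (λ a → a :- :0 :* a := a) refl (α i))))
                         (0≤α i)
    ∑α′ : ∑ α′ ≡ 1r - α p
    ∑α′ = trans (∑-sub α (λ i → δ p i * α i)) (cong₂ _-_ ∑α≡1 (∑-δ p α))
    L = η + (1r - α p)
    0<L : 0r < L
    0<L = +-pos-nonNeg 0<η (x≤y⇒0≤y-x (subst (α p ≤_) ∑α≡1 (≤-∑ 0≤α p)))
    l : Fin (suc N) → ℝ
    l j = (η ∷ α′) j / L
    0≤l : ∀ j → 0r ≤ l j
    0≤l zero = /-nonNeg (inj₁ 0<η) 0<L
    0≤l (suc i) = /-nonNeg (0≤α′ i) 0<L
    ∑/L : ∀ (Y : Fin (suc N) → ℝ) {t} → ∑ (λ j → (η ∷ α′) j * Y j) ≡ t * L → ∑ (λ j → l j * Y j) ≡ t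
    ∑/L Y {t} ∑≡tL = trans (∑-cong (λ j → solve 3 (λ a i y → a :* i :* y := a :* y :* i) refl ((η ∷ α′) j) (L ⁻¹) (Y j)))
      (trans (∑-*ʳ (L ⁻¹) (λ j → (η ∷ α′) j * Y j)) (trans (cong (_/ L) ∑≡tL) (*-/-cancel t (0<⇒≢0 0<L))))
    ∑l≡1 : ∑ l ≡ 1r
    ∑l≡1 = trans (∑-cong (λ j → sym (*-identityʳ (l j)))) (∑/L (λ _ → 1r)
      (trans (∑-cong (λ j → *-identityʳ ((η ∷ α′) j))) (trans (cong (η +_) ∑α′) (sym (*-identityˡ L)))))
    l·X≡Xp : lin l (λ j → X ((q ∷ λ i → i) j)) ≈ X p
    l·X≡Xp k = ∑/L (λ j → X ((q ∷ λ i → i) j) k) (begin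
      η * X q k + ∑ (λ i → α′ i * X i k)
        ≡⟨ cong (η * X q k +_) (trans (∑-cong (λ i → solve 3 (λ a d x → (a :- d :* a) :* x := a :* x :- d :* (a :* x)) refl (α i) (δ p i) (X i k)))
                                      (∑-sub (λ i → α i * X i k) (λ i → δ p i * (α i * X i k)))) ⟩
      η * X q k + (lin α X k - ∑ (λ i → δ p i * (α i * X i k)))
        ≡⟨ cong₂ (λ u v → η * X q k + (u - v)) (α·X≡z k) (∑-δ p (λ i → α i * X i k)) ⟩
      η * X q k + ((X p k + η * (X p k - X q k)) - α p * X p k)
        ≡⟨ solve 4 (λ e w y a → e :* w :+ ((y :+ e :* (y :- w)) :- a :* y) := y :* (e :+ (:1 :- a))) refl η (X q k) (X p k) (α p) ⟩
      X p k * L ∎)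
      where open ≡-Reasoning
    avoids : ∀ j → (q ∷ λ i → i) j ≡ p → l j ≡ 0r
    avoids zero q≡p = ⊥-elim (q≢p q≡p)
    avoids (suc i) refl = trans (cong (_/ L) α′p≡0) (zeroˡ (L ⁻¹))

  openSimplex⇒interior : AffGenPos X ⊤ → ∀ {p ps c} → InOpenSimplex p ps c → InConv₀ X ⊤ (X p)
  openSimplex⇒interior genPos {ps = ps} (ps-inj , _ , c∈⟨0,1⟩ , ∑c≡1 , Xp≡c·X) =
    positiveCombination⇒interior ps (genPos ps ps-inj (λ _ → ∈⊤)) (λ j → proj₁ (c∈⟨0,1⟩ j)) ∑c≡1 (λ k → sym (Xp≡c·X k))

  interior⇒¬¬openSimplex : AffGenPos X ⊤ → 0 ℕ.< m → ∀ p → InConv₀ X ⊤ (X p) →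
    ¬ ¬ (∃[ ps ] ∃[ c ] InOpenSimplex p ps c)
  interior⇒¬¬openSimplex genPos 0<m p interior noSimplex =
    Carathéodory.noRepresentation genPos m<N 0<m p noSimplex (suc N) (proj₂ representation)
    where
    m<N = interior⇒dimension≤ X interior
    other = anotherElement (ℕ.≤-trans (s≤s 0<m) m<N) p
    extension = interior⇒extendable interior (X (proj₁ other))
    representation = extension⇒representation (proj₂ other) (proj₁ (proj₂ extension)) (proj₂ (proj₂ extension))

  boundary⇔¬openSimplex : AffGenPos X ⊤ → 0 ℕ.< m → ∀ p →
    (¬ InConv₀ X ⊤ (X p)) ⇔ (¬ (∃[ ps ] ∃[ c ] InOpenSimplex p ps c))
  boundary⇔¬openSimplex genPos 0<m p = mk⇔
    (λ boundary (ps , c , simplex) → boundary (openSimplex⇒interior genPos simplex))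
    (λ noSimplex interior → interior⇒¬¬openSimplex genPos 0<m p interior noSimplex)

module CapCup (R : RealField) {k n : ℕ} (C : Fin n → Geometry.Pt R (suc (suc k))) where
  open import Data.Fin as Fin using (zero; suc)
  import Data.Fin.Subset as Subset
  open import Data.Fin.Subset.Properties using (∈⊤; x∈p∧x≢y⇒x∈p-y)
  open import Data.Vec.Functional using (_∷_)
  open import Data.Product using (proj₁; ∃-syntax)
  open import Data.Empty using (⊥-elim)
  open import Relation.Nullary using (¬_; yes; no)
  open import Relation.Binary.Definitions using (tri<; tri≈; tri>)

  open LinearAlgebra R
  open FinMaps
  open ConvexGeometry R (λ i → π (C i)) public

  facetHeight : (Fin (suc (suc k)) → Fin n) → (Fin (suc (suc k)) → ℝ) → ℝ
  facetHeight ps c = ∑ (λ j → c j * h (C (ps j)))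

  Below Above : Fin n → Set
  Below p = ∃[ ps ] ∃[ c ] (InOpenSimplex p ps c × h (C p) < facetHeight ps c)
  Above p = ∃[ ps ] ∃[ c ] (InOpenSimplex p ps c × facetHeight ps c < h (C p))

  genPos⇒¬onFacet : GenPos C ⊤ → ∀ {p ps c} → InOpenSimplex p ps c → h (C p) ≢ facetHeight ps c
  genPos⇒¬onFacet genPos {p} {ps} {c} (ps-inj , ps≢p , _ , ∑c≡1 , πCp≡) hCp≡ =
    -1≢0 (genPos (p ∷ ps) (∷-injective ps-inj ps≢p) (λ _ → ∈⊤) (- 1r ∷ c)
                 (trans (cong (- 1r +_) ∑c≡1) (-‿inverseˡ 1r)) dependent zero)
    where
    cancel : ∀ {a b} → a ≡ b → - 1r * a + b ≡ 0r
    cancel {a} refl = solve 1 (λ a → (:- :1) :* a :+ a := :0) refl a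
    dependent : lin (- 1r ∷ c) (λ j → C ((p ∷ ps) j)) ≈ 0v
    dependent = π-h-≈ (λ l → cancel (πCp≡ l)) (cancel hCp≡)

  openSimplex⇒Below⊎Above : GenPos C ⊤ → ∀ {p ps c} → InOpenSimplex p ps c → Below p ⊎ Above p
  openSimplex⇒Below⊎Above genPos {p} {ps} {c} simplex with compare (h (C p)) (facetHeight ps c)
  ... | tri< below _ _ = inj₁ (ps , c , simplex , below)
  ... | tri≈ _ onFacet _ = ⊥-elim (genPos⇒¬onFacet genPos simplex onFacet)
  ... | tri> _ _ above = inj₂ (ps , c , simplex , above)

  ¬Below⇒cap : GenPos C ⊤ → ∀ {M} → (∀ {p} → p ∈ M → ¬ Below p) → CupCapCond (λ a b → b < a) C M
  ¬Below⇒cap genPos ¬below p ps c p∈M _ ps-inj ps≢p c∈⟨0,1⟩ ∑c≡1 πCp≡ with compare (facetHeight ps c) (h (C p))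
  ... | tri< above _ _ = above
  ... | tri≈ _ onFacet _ = ⊥-elim (genPos⇒¬onFacet genPos (ps-inj , ps≢p , c∈⟨0,1⟩ , ∑c≡1 , πCp≡) (sym onFacet))
  ... | tri> _ _ below = ⊥-elim (¬below p∈M (ps , c , (ps-inj , ps≢p , c∈⟨0,1⟩ , ∑c≡1 , πCp≡) , below))

  ¬Above⇒cup : GenPos C ⊤ → ∀ {M} → (∀ {p} → p ∈ M → ¬ Above p) → CupCapCond _<_ C M
  ¬Above⇒cup genPos ¬above p ps c p∈M _ ps-inj ps≢p c∈⟨0,1⟩ ∑c≡1 πCp≡ with compare (h (C p)) (facetHeight ps c)
  ... | tri< below _ _ = below
  ... | tri≈ _ onFacet _ = ⊥-elim (genPos⇒¬onFacet genPos (ps-inj , ps≢p , c∈⟨0,1⟩ , ∑c≡1 , πCp≡) onFacet)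
  ... | tri> _ _ above = ⊥-elim (¬above p∈M (ps , c , (ps-inj , ps≢p , c∈⟨0,1⟩ , ∑c≡1 , πCp≡) , above))

  -- With a = h (C p) - H′ and b = H - h (C p), the weights (a u + b u′) / (a + b) of the two simplices
  -- keep π (C p) and average the heights H′ < h (C p) < H to h (C p).
  Below×Above⇒inHullOfOthers : ∀ {p} → Below p → Above p → InConv C (⊤ Subset.- p) (C p)
  Below×Above⇒inHullOfOthers {p} (ps , c , (_ , ps≢p , c∈⟨0,1⟩ , ∑c≡1 , πCp≡) , hCp<H)
                                 (ps′ , c′ , (_ , ps′≢p , c′∈⟨0,1⟩ , ∑c′≡1 , πCp≡′) , H′<hCp) =
    α , supported , 0≤α , ∑α≡1 , α·C≡Cp
    where
    H = facetHeight ps c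
    H′ = facetHeight ps′ c′
    a = h (C p) - H′
    b = H - h (C p)
    0<a = x<y⇒0<y-x H′<hCp
    0<b = x<y⇒0<y-x hCp<H
    0<a+b = +-pos-nonNeg 0<a (inj₁ 0<b)
    u = pushforward ps c
    u′ = pushforward ps′ c′
    α = mixture a b u u′
    ∑α· : ∀ Y → ∑ (λ i → α i * Y i) ≡ (a * ∑ (λ j → c j * Y (ps j)) + b * ∑ (λ j → c′ j * Y (ps′ j))) / (a + b)
    ∑α· Y = trans (∑-mixture a b u u′ Y) (cong (λ z → z / (a + b)) (cong₂ (λ s t → a * s + b * t)
                                                                          (∑-pushforward ps c Y) (∑-pushforward ps′ c′ Y)))
    average : ∀ {y s t} → s ≡ y → t ≡ y → (a * s + b * t) / (a + b) ≡ y
    average {y} refl refl = trans (cong (_/ (a + b)) (solve 3 (λ a b y → a :* y :+ b :* y := y :* (a :+ b)) refl a b y))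
                                  (*-/-cancel y (0<⇒≢0 0<a+b))
    αp≡0 : α p ≡ 0r
    αp≡0 = trans (cong (_/ (a + b)) (trans (cong₂ (λ s t → a * s + b * t) (pushforward-outside ps c ps≢p) (pushforward-outside ps′ c′ ps′≢p))
                                           (solve 2 (λ a b → a :* :0 :+ b :* :0 := :0) refl a b)))
                 (zeroˡ _)
    supported : SupportedOn (⊤ Subset.- p) α
    supported i i∉ with i Fin.≟ p
    ... | yes refl = αp≡0
    ... | no i≢p = ⊥-elim (i∉ (x∈p∧x≢y⇒x∈p-y ∈⊤ i≢p))
    0≤α : ∀ i → 0r ≤ α i
    0≤α i = /-nonNeg (+-nonNeg (*-nonNeg (inj₁ 0<a) (pushforward-nonNeg ps (λ j → inj₁ (proj₁ (c∈⟨0,1⟩ j))) i))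
                               (*-nonNeg (inj₁ 0<b) (pushforward-nonNeg ps′ (λ j → inj₁ (proj₁ (c′∈⟨0,1⟩ j))) i)))
                     0<a+b
    ∑α≡1 : ∑ α ≡ 1r
    ∑α≡1 = trans (∑-cong (λ i → sym (*-identityʳ (α i)))) (trans (∑α· (λ _ → 1r))
      (average (trans (∑-cong (λ j → *-identityʳ (c j))) ∑c≡1) (trans (∑-cong (λ j → *-identityʳ (c′ j))) ∑c′≡1)))
    α·C≡Cp : lin α C ≈ C p
    α·C≡Cp = π-h-≈ (λ l → trans (∑α· (λ i → π (C i) l)) (average (sym (πCp≡ l)) (sym (πCp≡′ l))))
      (trans (∑α· (λ i → h (C i))) (trans (cong (_/ (a + b))
        (solve 3 (λ y H H′ → (y :- H′) :* H :+ (H :- y) :* H′ := y :* ((y :- H′) :+ (H :- y))) refl (h (C p)) H H′))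
        (*-/-cancel (h (C p)) (0<⇒≢0 0<a+b))))

  regular-⊤⇒regular : Regular C ⊤ → ∀ M → Regular C M
  regular-⊤⇒regular (r1 , r2 , r3) M =
    (λ l i j _ _ → r1 l i j ∈⊤ ∈⊤) , (λ f f-inj _ → r2 f f-inj (λ _ → ∈⊤)) , (λ S T _ _ → r3 S T (λ _ → ∈⊤) (λ _ → ∈⊤))


proposition5 : (R : RealField) → let open Geometry R in
    (k n : ℕ) (C : Fin n → Pt (suc (suc k))) →
    Regular C ⊤ → ConvexIndependent C →
    Σ[ A ∈ Subset n ] Σ[ B ∈ Subset n ]
      (ConvexCap C A × ConvexCup C B ×
       (∀ i → i ∈ A ⊎ i ∈ B) ×
       (∀ i → (i ∈ A × i ∈ B) ⇔ In∂π C i))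
proposition5 R k n C regular (genPos , vertices) =
  A , B , (regular-⊤⇒regular regular A , ¬Below⇒cap genPos (to (∈A⇔ _))) ,
          (regular-⊤⇒regular regular B , ¬Above⇒cup genPos (to (∈B⇔ _))) , cover , boundary
  where
  open Geometry R using (In∂π)
  open CapCup R C
  open WeakExcludedMiddle R
  open import Data.Nat using (s≤s; z≤n)
  open import Data.Product using (proj₁; proj₂)
  open import Data.Empty using (⊥)
  open Function.Bundles.Equivalence using (to; from)
  A = failures Below
  B = failures Above
  ∈A⇔ = ∈failures⇔¬ Below
  ∈B⇔ = ∈failures⇔¬ Above
  ¬Below×Above : ∀ {i} → Below i → Above i → ⊥
  ¬Below×Above {i} below above = vertices i (Below×Above⇒inHullOfOthers below above)
  cover : ∀ i → i ∈ A ⊎ i ∈ B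
  cover i with ¬⊎¬¬ (Below i)
  ... | inj₁ ¬below = inj₁ (from (∈A⇔ i) ¬below)
  ... | inj₂ ¬¬below = inj₂ (from (∈B⇔ i) (λ above → ¬¬below (λ below → ¬Below×Above below above)))
  ∂π⇔ = λ i → boundary⇔¬openSimplex (proj₁ (proj₂ regular)) (s≤s z≤n) i
  boundary : ∀ i → (i ∈ A × i ∈ B) ⇔ In∂π C i
  boundary i = mk⇔
    (λ (i∈A , i∈B) → from (∂π⇔ i) (λ (_ , _ , simplex) →
      [ to (∈A⇔ i) i∈A , to (∈B⇔ i) i∈B ] (openSimplex⇒Below⊎Above genPos simplex)))
    (λ i∈∂π → from (∈A⇔ i) (λ (_ , _ , simplex , _) → to (∂π⇔ i) i∈∂π (_ , _ , simplex))
            , from (∈B⇔ i) (λ (_ , _ , simplex , _) → to (∂π⇔ i) i∈∂π (_ , _ , simplex)))
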